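{- The functor $I^*:[\mathcal{C},\mathbf{Set}]\to\mathbf{01Sub}$ (defined in the context) is an equivalence of categories. In particular, the category of cubical sets $[\mathcal{C},\mathbf{Set}]$ is equivalent to the category $\mathbf{01Sub}$ of $01$-substitution sets.
   Context: Let $\mathbb{A}$ be a countably infinite set of names and $\mathrm{Perm}\,\mathbb{A}$ the group of finite permutations of $\mathbb{A}$ (permutations moving only finitely many names). A nominal set is a set $X$ with an action $(\pi,x)\mapsto \pi\cdot x$ of $\mathrm{Perm}\,\mathbb{A}$ such that every $x\in X$ has a finite support, i.e. a finite $A\subseteq\mathbb{A}$ such that every $\pi$ fixing each element of $A$ satisfies $\pi\cdot x=x$; $\mathrm{supp}\,x$ is the smallest such finite set, and $a\# x$ means $a\notin\mathrm{supp}\,x$. A function $f$ between nominal sets is equivariant if $f(\pi\cdot x)=\pi\cdot f(x)$. Let $2=\{0,1\}$ with trivial action, and $\mathbb{A}$ with action $\pi\cdot a=\pi(a)$. A $01$-substitution operation on a nominal set $X$ is an equivariant function $X\times\mathbb{A}\times 2\to X$, written $(x,a,i)\mapsto x(a:=i)$, such that for all $x\in X$, $a,a'\in\mathbb{A}$, $i,i'\in 2$: (i) $a\# x(a:=i)$; (ii) if $a\# x$ then $x(a:=i)=x$; (iii) if $a\neq a'$ then $x(a:=i)(a':=i')=x(a':=i')(a:=i)$. The category $\mathbf{01Sub}$ has as objects nominal sets equipped with a $01$-substitution operation, and as morphisms $X\to Y$ equivariant functions $f$ with $f(x(a:=i))=(f\,x)(a:=i)$ for all $x,a,i$. The category $\mathcal{C}$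 has as objects the finite subsets $A\subseteq\mathbb{A}$; a morphism $f\in\mathcal{C}(A,B)$ is a function $f:A\to B+2$ (disjoint union of $B$ and $\{0,1\}$) that is injective on $f^{ -1}B$. The identity on $A$ is $a\mapsto a$, and the composite of $f\in\mathcal{C}(A,B)$ and $g\in\mathcal{C}(B,C)$ is $(g\circ f)(a)=g(f(a))$ if $f(a)\in B$ and $(g\circ f)(a)=f(a)$ if $f(a)\in 2$. $[\mathcal{C},\mathbf{Set}]$ (the category of cubical sets) is the category of functors $\mathcal{C}\to\mathbf{Set}$ and natural transformations. For $A\subseteq B$ write $A\hookrightarrow B$ for the morphism $a\mapsto a$; for $\pi\in\mathrm{Perm}\,\mathbb{A}$ write $\pi|_A\in\mathcal{C}(A,\pi A)$ for $a\mapsto\pi(a)$; for $a\in\mathbb{A}$, $i\in 2$ let $f_{A,a,i}\in\mathcal{C}(A,A-\{a\})$ send $a$ to $i$ (if $a\in A$) and every $b\in A-\{a\}$ to $b$. The functor $I^*:[\mathcal{C},\mathbf{Set}]\to\mathbf{01Sub}$: for $F$, $I^*F$ is the set of equivalence classes $[A,x]$ of pairs with $A\in\mathcal{C}$, $x\in F\,A$, where $(A,x)\sim(A',x')$ iff there is a finite $B\supseteq A\cup A'$ with $F(A\hookrightarrow B)\,x=F(A'\hookrightarrow B)\,x'$; the action is $\pi\cdot[A,x]=[\pi A,F(\pi|_A)\,x]$ and the $01$-substitution is $[A,x](a:=i)=[A-\{a\},F(f_{A,a,i})\,x]$. For a natural transformation $\varphi:F\to F'$, $I^*\varphi[A,x]=[A,\varphi_A\,x]$.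 -}

module Defs where

open import Level using (0ℓ)
open import Data.Nat using (ℕ; zero; suc; _+_)
open import Data.Nat.Properties using (+-suc; +-assoc; suc-injective; _≟_)
open import Data.Bool using (Bool; true; false; T)
open import Data.Fin using (Fin)
open import Data.List using (List; []; _∷_; _++_)
open import Data.List.Membership.Propositional using (_∈_)
open import Data.List.Membership.Propositional.Properties using (∈-++⁺ˡ; ∈-++⁺ʳ)
open import Data.Product using (Σ; _×_; _,_; proj₁; proj₂)
open import Data.Sum using (_⊎_; inj₁; inj₂)
open import Data.Empty using (⊥; ⊥-elim)
open import Relation.Nullary using (¬_; Dec; yes; no)
open import Relation.Binary using (IsEquivalence)
open import Relation.Binary.Bundles using (Setoid)
open import Relation.Binary.PropositionalEquality
  using (_≡_; _≢_; refl; sym; trans; cong; subst)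

-- Names: 𝔸 = ℕ (a countably infinite set with decidable equality)

𝔸 : Set
𝔸 = ℕ

𝟚 : Set
𝟚 = Fin 2

-- Finite subsets of 𝔸, canonically encoded by "gap lists":
-- (g ∷ gs) denotes {g} ∪ { g + 1 + x | x ∈ gs }.
-- Every list is a valid code and distinct lists denote distinct sets.

FinSub : Set
FinSub = List ℕ

mutual
  mem : ℕ → FinSub → Bool
  mem a []       = false
  mem a (g ∷ gs) = memg a g gs

  memg : ℕ → ℕ → FinSub → Bool
  memg zero    zero    gs = true
  memg zero    (suc g) gs = false
  memg (suc a) zero    gs = mem a gs
  memg (suc a) (suc g) gs = memg a g gs

infix 4 _∈ˢ_ _⊆ˢ_
_∈ˢ_ : ℕ → FinSub → Set
a ∈ˢ A = T (mem a A)

_⊆ˢ_ : FinSub → FinSub → Set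
A ⊆ˢ B = ∀ a → a ∈ˢ A → a ∈ˢ B

-- shift a finite set up by one
bump : FinSub → FinSub
bump []      = []
bump (h ∷ t) = suc h ∷ t

mutual
  insert : ℕ → FinSub → FinSub
  insert a []       = a ∷ []
  insert a (g ∷ gs) = insg a g gs

  insg : ℕ → ℕ → FinSub → FinSub
  insg zero    zero    gs = zero ∷ gs
  insg zero    (suc g) gs = zero ∷ g ∷ gs
  insg (suc a) zero    gs = zero ∷ insert a gs
  insg (suc a) (suc g) gs = bump (insg a g gs)

mutual
  remove : ℕ → FinSub → FinSub
  remove a []       = []
  remove a (g ∷ gs) = remg a g gs

  remg : ℕ → ℕ → FinSub → FinSub
  remg zero    zero    gs = bump gs
  remg zero    (suc g) gs = suc g ∷ gs
  remg (suc a) zero    gs = zero ∷ remove a gs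
  remg (suc a) (suc g) gs = bump (remg a g gs)

imageAux : (ℕ → ℕ) → ℕ → FinSub → FinSub
imageAux f o []       = []
imageAux f o (g ∷ gs) = insert (f (o + g)) (imageAux f (suc (o + g)) gs)

image : (ℕ → ℕ) → FinSub → FinSub
image f A = imageAux f 0 A

mem-bump : ∀ a s → mem (suc a) (bump s) ≡ mem a s
mem-bump a []      = refl
mem-bump a (h ∷ t) = refl

mutual
  rem-mem : ∀ a b A → b ∈ˢ A → b ≢ a → b ∈ˢ remove a A
  rem-mem a b []       () ne
  rem-mem a b (g ∷ gs) p  ne = remg-mem a b g gs p ne

  remg-mem : ∀ a b g gs → T (memg b g gs) → b ≢ a → b ∈ˢ remg a g gs
  remg-mem zero    zero    zero    gs p ne = ⊥-elim (ne refl)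
  remg-mem zero    (suc b) zero    gs p ne = subst T (sym (mem-bump b gs)) p
  remg-mem zero    b       (suc g) gs p ne = p
  remg-mem (suc a) zero    zero    gs p ne = p
  remg-mem (suc a) (suc b) zero    gs p ne = rem-mem a b gs p (λ e → ne (cong suc e))
  remg-mem (suc a) zero    (suc g) gs () ne
  remg-mem (suc a) (suc b) (suc g) gs p ne =
    subst T (sym (mem-bump b (remg a g gs))) (remg-mem a b g gs p (λ e → ne (cong suc e)))

memg-self : ∀ a gs → T (memg a a gs)
memg-self zero    gs = _
memg-self (suc a) gs = memg-self a gs

mutual
  ins-here : ∀ a A → a ∈ˢ insert a A
  ins-here a []       = memg-self a []
  ins-here a (g ∷ gs) = insg-here a g gs

  insg-here : ∀ a g gs → a ∈ˢ insg a g gs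
  insg-here zero    zero    gs = _
  insg-here zero    (suc g) gs = _
  insg-here (suc a) zero    gs = ins-here a gs
  insg-here (suc a) (suc g) gs = subst T (sym (mem-bump a (insg a g gs))) (insg-here a g gs)

mutual
  ins-there : ∀ a b A → b ∈ˢ A → b ∈ˢ insert a A
  ins-there a b []       ()
  ins-there a b (g ∷ gs) p = insg-there a b g gs p

  insg-there : ∀ a b g gs → T (memg b g gs) → b ∈ˢ insg a g gs
  insg-there zero    b       zero    gs p = p
  insg-there zero    zero    (suc g) gs ()
  insg-there zero    (suc b) (suc g) gs p = p
  insg-there (suc a) zero    zero    gs p = _
  insg-there (suc a) (suc b) zero    gs p = ins-there a b gs p
  insg-there (suc a) zero    (suc g) gs ()
  insg-there (suc a) (suc b) (suc g) gs p =
    subst T (sym (mem-bump b (insg a g gs))) (insg-there a b g gs p)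

memg-split : ∀ a g gs → T (memg a g gs) →
             (a ≡ g) ⊎ Σ ℕ (λ a' → (a ≡ suc (g + a')) × a' ∈ˢ gs)
memg-split zero    zero    gs p = inj₁ refl
memg-split zero    (suc g) gs ()
memg-split (suc a) zero    gs p = inj₂ (a , refl , p)
memg-split (suc a) (suc g) gs p with memg-split a g gs p
... | inj₁ e              = inj₁ (cong suc e)
... | inj₂ (a' , e , q)   = inj₂ (a' , cong suc e , q)

imageAux-mem : ∀ f o a A → a ∈ˢ A → f (o + a) ∈ˢ imageAux f o A
imageAux-mem f o a []       ()
imageAux-mem f o a (g ∷ gs) p with memg-split a g gs p
... | inj₁ refl = ins-here (f (o + a)) (imageAux f (suc (o + a)) gs)
... | inj₂ (a' , refl , q) =
  ins-there (f (o + g)) (f (o + suc (g + a'))) (imageAux f (suc (o + g)) gs)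
    (subst (λ n → f n ∈ˢ imageAux f (suc (o + g)) gs) eq
      (imageAux-mem f (suc (o + g)) a' gs q))
  where
  eq : suc (o + g) + a' ≡ o + suc (g + a')
  eq = trans (cong suc (+-assoc o g a')) (sym (+-suc o (g + a')))

image-mem : ∀ f a A → a ∈ˢ A → f a ∈ˢ image f A
image-mem f a A p = imageAux-mem f 0 a A p

-- The category 𝒞: objects are finite subsets A ⊆ 𝔸; a morphism A → B
-- is a function A → B + 2 that is injective on the preimage of B.

El : FinSub → Set
El A = Σ ℕ (λ a → a ∈ˢ A)

record Hom (A B : FinSub) : Set where
  field
    fun : (a : ℕ) → a ∈ˢ A → El B ⊎ 𝟚
    inj : ∀ a p a' p' (e : El B) → fun a p ≡ inj₁ e → fun a' p' ≡ inj₁ e → a ≡ a'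
open Hom public

_≈𝒞_ : ∀ {A B} → Hom A B → Hom A B → Set
f ≈𝒞 g = ∀ a p → fun f a p ≡ fun g a p

private
  inj₁-val : ∀ B {d e : El B} → _≡_ {A = El B ⊎ 𝟚} (inj₁ d) (inj₁ e) → proj₁ d ≡ proj₁ e
  inj₁-val B refl = refl

id𝒞 : ∀ {A} → Hom A A
id𝒞 {A} = record { fun = λ a p → inj₁ (a , p)
             ; inj = λ a p a' p' e h h' → trans (inj₁-val A h) (sym (inj₁-val A h')) }

private
  ∘fun : ∀ {B C} → Hom B C → (El B ⊎ 𝟚) → El C ⊎ 𝟚
  ∘fun g (inj₁ (b , q)) = g .fun b q
  ∘fun g (inj₂ i)       = inj₂ i

  ∘inv : ∀ {B C} (g : Hom B C) (u : El B ⊎ 𝟚) (e : El C) → ∘fun g u ≡ inj₁ e →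
         Σ (El B) (λ d → (u ≡ inj₁ d) × (g .fun (proj₁ d) (proj₂ d) ≡ inj₁ e))
  ∘inv g (inj₁ d) e eq = d , refl , eq
  ∘inv g (inj₂ i) e ()

  T-irr : ∀ b (p q : T b) → p ≡ q
  T-irr true  p q = refl
  T-irr false () q

  El-≡ : ∀ B (d d' : El B) → proj₁ d ≡ proj₁ d' → d ≡ d'
  El-≡ B (b , q) (.b , q') refl = cong (b ,_) (T-irr (mem b B) q q')

_∘𝒞_ : ∀ {A B C} → Hom B C → Hom A B → Hom A C
_∘𝒞_ {A} {B} {C} g f = record { fun = λ a p → ∘fun g (f .fun a p) ; inj = injp }
  where
  injp : ∀ a p a' p' (e : El C) → ∘fun g (f .fun a p) ≡ inj₁ e →
         ∘fun g (f .fun a' p') ≡ inj₁ e → a ≡ a'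
  injp a p a' p' e h h' with ∘inv g (f .fun a p) e h | ∘inv g (f .fun a' p') e h'
  ... | (d , fd , gd) | (d' , fd' , gd') =
    f .inj a p a' p' d fd
      (trans fd' (cong inj₁ (El-≡ B d' d (sym (g .inj (proj₁ d) (proj₂ d) (proj₁ d') (proj₂ d') e gd gd')))))

incl : ∀ {A B} → A ⊆ˢ B → Hom A B
incl {A} {B} s = record { fun = λ a p → inj₁ (a , s a p)
                ; inj = λ a p a' p' e h h' → trans (inj₁-val B h) (sym (inj₁-val B h')) }

record Perm : Set where
  field
    to      : ℕ → ℕ
    from    : ℕ → ℕ
    to-from : ∀ a → to (from a) ≡ a
    from-to : ∀ a → from (to a) ≡ a
    moved   : List ℕ
    finite  : ∀ a → ¬ (a ∈ moved) → to a ≡ a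
open Perm public

idP : Perm
idP = record { to = λ a → a ; from = λ a → a ; to-from = λ _ → refl ; from-to = λ _ → refl
             ; moved = [] ; finite = λ _ _ → refl }

_∘P_ : Perm → Perm → Perm
π ∘P σ = record
  { to = λ a → to π (to σ a)
  ; from = λ a → from σ (from π a)
  ; to-from = λ a → trans (cong (to π) (to-from σ (from π a))) (to-from π a)
  ; from-to = λ a → trans (cong (from σ) (from-to π (to σ a))) (from-to σ a)
  ; moved = moved π ++ moved σ
  ; finite = λ a h → trans (cong (to π) (finite σ a (λ m → h (∈-++⁺ʳ (moved π) m))))
                           (finite π a (λ m → h (∈-++⁺ˡ m)))
  }

restrict : (π : Perm) (A : FinSub) → Hom A (image (to π) A)
restrict π A = record
  { fun = λ a p → inj₁ (to π a , image-mem (to π) a A p)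
  ; inj = λ a p a' p' e h h' → trans (sym (from-to π a))
                (trans (cong (from π) (trans (inj₁-val (image (to π) A) h) (sym (inj₁-val (image (to π) A) h')))) (from-to π a')) }

private
  fsubfun : (A : FinSub) (a : ℕ) (i : 𝟚) (b : ℕ) → b ∈ˢ A → Dec (b ≡ a) → El (remove a A) ⊎ 𝟚
  fsubfun A a i b p (yes _) = inj₂ i
  fsubfun A a i b p (no ne) = inj₁ (b , rem-mem a b A p ne)

  fsubfun-inv : ∀ A a i b p d e → fsubfun A a i b p d ≡ inj₁ e → b ≡ proj₁ e
  fsubfun-inv A a i b p (yes _) e ()
  fsubfun-inv A a i b p (no ne) e refl = refl

fsub : (A : FinSub) (a : ℕ) (i : 𝟚) → Hom A (remove a A)
fsub A a i = record
  { fun = λ b p → fsubfun A a i b p (b ≟ a)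
  ; inj = λ b p b' p' e h h' → trans (fsubfun-inv A a i b p (b ≟ a) e h)
                                     (sym (fsubfun-inv A a i b' p' (b' ≟ a) e h')) }

-- Since Agda has no quotient types,
-- carriers come with an equality relation _≈_ (a setoid); all laws are
-- stated up to _≈_.  The operations and the laws are kept separate so
-- that I* F can be defined before proving that it satisfies the laws.

record Raw01Sub : Set₁ where
  field
    Carrier : Set
    _≈_     : Carrier → Carrier → Set
    act     : Perm → Carrier → Carrier
    sub     : Carrier → 𝔸 → 𝟚 → Carrier

  Supports : FinSub → Carrier → Set
  Supports A x = ∀ (π : Perm) → (∀ a → a ∈ˢ A → to π a ≡ a) → act π x ≈ x

  -- a # x : a lies outside some (equivalently: the least) finite support of x
  _#_ : 𝔸 → Carrier → Set
  a # x = Σ FinSub (λ A → Supports A x × ¬ (a ∈ˢ A))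

record IsNominal (X : Raw01Sub) : Set where
  open Raw01Sub X
  field
    isEquivalence : IsEquivalence _≈_
    act-cong : ∀ π {x y} → x ≈ y → act π x ≈ act π y
    act-ext  : ∀ (π σ : Perm) → (∀ a → to π a ≡ to σ a) → ∀ x → act π x ≈ act σ x
    act-id   : ∀ x → act idP x ≈ x
    act-comp : ∀ π σ x → act (π ∘P σ) x ≈ act π (act σ x)
    finsupp  : ∀ x → Σ FinSub (λ A → Supports A x)

record Is01Sub (X : Raw01Sub) : Set where
  open Raw01Sub X
  field
    isNominal : IsNominal X
    sub-cong  : ∀ {x y} a i → x ≈ y → sub x a i ≈ sub y a i
    sub-equiv : ∀ π x a i → act π (sub x a i) ≈ sub (act π x) (to π a) i
    sub-fresh : ∀ x a i → a # sub x a i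
    fresh-sub : ∀ x a i → a # x → sub x a i ≈ x
    sub-comm  : ∀ x a a' i i' → a ≢ a' → sub (sub x a i) a' i' ≈ sub (sub x a' i') a i

record IsHom (X Y : Raw01Sub) (f : Raw01Sub.Carrier X → Raw01Sub.Carrier Y) : Set where
  private
    module X = Raw01Sub X
    module Y = Raw01Sub Y
  field
    hom-cong  : ∀ {x y} → x X.≈ y → f x Y.≈ f y
    hom-equiv : ∀ π x → f (X.act π x) Y.≈ Y.act π (f x)
    hom-sub   : ∀ x a i → f (X.sub x a i) Y.≈ Y.sub (f x) a i

-- Cubical sets: functors 𝒞 → Set (Set rendered as setoids), and
-- natural transformations.

record Presheaf : Set₁ where
  field
    obj : FinSub → Setoid 0ℓ 0ℓ
  ∣_∣ : FinSub → Set
  ∣ A ∣ = Setoid.Carrier (obj A)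
  EqAt : (A : FinSub) → ∣ A ∣ → ∣ A ∣ → Set
  EqAt A x y = Setoid._≈_ (obj A) x y
  syntax EqAt A x y = x ≈[ A ] y
  field
    map      : ∀ {A B} → Hom A B → ∣ A ∣ → ∣ B ∣
    map-cong : ∀ {A B} (f : Hom A B) {x y} → x ≈[ A ] y → map f x ≈[ B ] map f y
    map-resp : ∀ {A B} {f g : Hom A B} → f ≈𝒞 g → ∀ x → map f x ≈[ B ] map g x
    map-id   : ∀ {A} x → map (id𝒞 {A}) x ≈[ A ] x
    map-∘    : ∀ {A B C} (f : Hom A B) (g : Hom B C) x →
               map (g ∘𝒞 f) x ≈[ C ] map g (map f x)

record NatTrans (F G : Presheaf) : Set where
  private
    module F = Presheaf F
    module G = Presheaf G
  field
    η       : ∀ A → F.∣ A ∣ → G.∣ A ∣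
    η-cong  : ∀ A {x y} → F.EqAt A x y → G.EqAt A (η A x) (η A y)
    natural : ∀ {A B} (f : Hom A B) x → G.EqAt B (η B (F.map f x)) (G.map f (η A x))
open NatTrans public

_≈N_ : ∀ {F G} → NatTrans F G → NatTrans F G → Set
_≈N_ {F} {G} φ ψ = ∀ A x → Presheaf.EqAt G A (η φ A x) (η ψ A x)

idN : ∀ {F} → NatTrans F F
idN {F} = record
  { η = λ A x → x
  ; η-cong = λ A e → e
  ; natural = λ {A} {B} f x → Setoid.refl (Presheaf.obj F B) }

_∘N_ : ∀ {F G H} → NatTrans G H → NatTrans F G → NatTrans F H
_∘N_ {F} {G} {H} ψ φ = record
  { η = λ A x → η ψ A (η φ A x)
  ; η-cong = λ A e → η-cong ψ A (η-cong φ A e)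
  ; natural = λ {A} {B} f x → Setoid.trans (Presheaf.obj H B)
      (η-cong ψ B (natural φ f x)) (natural ψ f (η φ A x)) }

I* : Presheaf → Raw01Sub
I* F = record
  { Carrier = Σ FinSub (λ A → ∣ A ∣)
  ; _≈_ = λ { (A , x) (A' , x') →
        Σ FinSub (λ B → Σ (A ⊆ˢ B) (λ s → Σ (A' ⊆ˢ B) (λ s' →
          map (incl s) x ≈[ B ] map (incl s') x'))) }
  ; act = λ { π (A , x) → image (to π) A , map (restrict π A) x }
  ; sub = λ { (A , x) a i → remove a A , map (fsub A a i) x }
  }
  where open Presheaf F

I*₁ : ∀ {F G} → NatTrans F G → Raw01Sub.Carrier (I* F) → Raw01Sub.Carrier (I* G)
I*₁ φ (A , x) = A , η φ A x

I*-IsFunctor : Set₁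
I*-IsFunctor =
    (∀ F → Is01Sub (I* F))
  × (∀ F G (φ : NatTrans F G) → IsHom (I* F) (I* G) (I*₁ φ))
  × (∀ F G (φ ψ : NatTrans F G) → φ ≈N ψ →
       ∀ u → Raw01Sub._≈_ (I* G) (I*₁ φ u) (I*₁ ψ u))
  × (∀ F u → Raw01Sub._≈_ (I* F) (I*₁ (idN {F}) u) u)
  × (∀ F G H (φ : NatTrans F G) (ψ : NatTrans G H) u →
       Raw01Sub._≈_ (I* H) (I*₁ (ψ ∘N φ) u) (I*₁ ψ (I*₁ φ u)))

I*-Faithful : Set₁
I*-Faithful = ∀ F G (φ ψ : NatTrans F G) →
  (∀ u → Raw01Sub._≈_ (I* G) (I*₁ φ u) (I*₁ ψ u)) → φ ≈N ψ

I*-Full : Set₁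
I*-Full = ∀ F G (g : Raw01Sub.Carrier (I* F) → Raw01Sub.Carrier (I* G)) →
  IsHom (I* F) (I* G) g →
  Σ (NatTrans F G) (λ φ → ∀ u → Raw01Sub._≈_ (I* G) (I*₁ φ u) (g u))

I*-EssSurj : Set₁
I*-EssSurj = ∀ (X : Raw01Sub) → Is01Sub X →
  Σ Presheaf (λ F →
  Σ (Raw01Sub.Carrier (I* F) → Raw01Sub.Carrier X) (λ f →
  Σ (Raw01Sub.Carrier X → Raw01Sub.Carrier (I* F)) (λ g →
      IsHom (I* F) X f
    × IsHom X (I* F) g
    × (∀ x → Raw01Sub._≈_ X (f (g x)) x)
    × (∀ u → Raw01Sub._≈_ (I* F) (g (f u)) u))))

-- A class [A , x] of I* F only depends on the values of the morphisms of 𝒞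
-- applied to x, which makes I* F a 01-substitution set and I* a functor. An
-- element of I* F supported by A is represented at stage A (through a
-- retraction onto A); this makes I* faithful, and full because morphisms of
-- 01Sub preserve supports. Conversely, a 01-substitution set X is recovered
-- from the cubical set A ↦ {x ∈ X | A supports x}: a morphism f ∈ 𝒞(A, B) acts
-- on it by first substituting constants for the names f sends into 2, then
-- renaming the remaining names by a finite permutation extending f.

module Submission where

open import Level using (0ℓ)
open import Defs
open import Data.Nat using (ℕ; zero; suc; _+_; _≤_)
open import Data.Nat.Properties using (+-suc; +-assoc; _≟_; ≤-trans; m≤m+n; m≤n+m; 1+n≰n; suc-injective)
open import Data.Nat.ListAction using (sum)
open import Data.Bool using (Bool; true; false; T; T?)
open import Data.Bool.Properties using (T-irrelevant)
open import Data.Unit using (tt)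
open import Data.Fin using () renaming (zero to fz)
open import Data.Maybe using (Maybe; just; nothing; _<∣>_; _>>=_; maybe′)
import Data.Maybe.Properties as Maybe
import Data.Fin as Fin
open import Data.List using (List; []; _∷_; _++_; foldr; filter) renaming (map to lmap)
open import Function using (_∘_)
open import Data.List.Membership.Propositional using (_∈_)
open import Data.List.Membership.Propositional.Properties
  using (∈-++⁺ˡ; ∈-++⁺ʳ; ∈-map⁺; ∈-filter⁺; ∈-filter⁻)
open import Data.List.Relation.Unary.Any using (here; there)
open import Data.List.Relation.Unary.All.Properties using (¬Any⇒All¬; All¬⇒¬Any)
open import Data.List.Relation.Unary.Unique.Propositional using (Unique; []; _∷_)
import Data.List.Relation.Unary.Unique.Propositional.Properties as Unique
open import Data.Product using (Σ; _×_; _,_; proj₁; proj₂)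
open import Data.Sum using (_⊎_; inj₁; inj₂)
open import Data.Sum.Properties using (inj₁-injective)
open import Data.Empty using (⊥-elim)
open import Relation.Nullary using (¬_; Dec; yes; no; ¬?; _×-dec_)
open import Relation.Binary using (IsEquivalence)
open import Relation.Binary.Bundles using (Setoid)
import Relation.Binary.Reasoning.Setoid as SetoidReasoning
open import Relation.Binary.PropositionalEquality using (_≡_; _≢_; refl; sym; trans; cong; subst; module ≡-Reasoning)

_∈ˢ?_ : ∀ a A → Dec (a ∈ˢ A)
a ∈ˢ? A = T? (mem a A)

El-≡ : ∀ B (d d' : El B) → proj₁ d ≡ proj₁ d' → d ≡ d'
El-≡ B (b , q) (.b , q') refl = cong (b ,_) (T-irrelevant q q')

mem-zero-bump : ∀ s → mem 0 (bump s) ≡ false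
mem-zero-bump []      = refl
mem-zero-bump (h ∷ t) = refl

∈-remove⁻ : ∀ a b A → b ∈ˢ remove a A → b ∈ˢ A × b ≢ a
∈-remove⁻ a b [] ()
∈-remove⁻ zero    zero    (zero ∷ gs)  p rewrite mem-zero-bump gs = ⊥-elim p
∈-remove⁻ zero    (suc b) (zero ∷ gs)  p = subst T (mem-bump b gs) p , λ ()
∈-remove⁻ zero    zero    (suc g ∷ gs) ()
∈-remove⁻ zero    (suc b) (suc g ∷ gs) p = p , λ ()
∈-remove⁻ (suc a) zero    (zero ∷ gs)  p = tt , λ ()
∈-remove⁻ (suc a) (suc b) (zero ∷ gs)  p with ∈-remove⁻ a b gs p
... | q , b≢a = q , λ e → b≢a (suc-injective e)
∈-remove⁻ (suc a) zero    (suc g ∷ gs) p rewrite mem-zero-bump (remg a g gs) = ⊥-elim p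
∈-remove⁻ (suc a) (suc b) (suc g ∷ gs) p
  with ∈-remove⁻ a b (g ∷ gs) (subst T (mem-bump b (remg a g gs)) p)
... | q , b≢a = q , λ e → b≢a (suc-injective e)

∉-remove : ∀ a A → ¬ (a ∈ˢ remove a A)
∉-remove a A m = proj₂ (∈-remove⁻ a a A m) refl

-- The names of a gap list whose first gap is counted from o.
elementsFrom : ℕ → FinSub → List ℕ
elementsFrom o []       = []
elementsFrom o (g ∷ gs) = (o + g) ∷ elementsFrom (suc (o + g)) gs

elements : FinSub → List ℕ
elements = elementsFrom 0

private
  shift-+ : ∀ o g a → suc (o + g) + a ≡ o + suc (g + a)
  shift-+ o g a = trans (cong suc (+-assoc o g a)) (sym (+-suc o (g + a)))

  memg-shift : ∀ g a gs → memg (suc (g + a)) g gs ≡ mem a gs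
  memg-shift zero    a gs = refl
  memg-shift (suc g) a gs = memg-shift g a gs

  ∈-elementsFrom⁺ : ∀ o a A → a ∈ˢ A → o + a ∈ elementsFrom o A
  ∈-elementsFrom⁺ o a (g ∷ gs) p with memg-split a g gs p
  ... | inj₁ refl = here refl
  ... | inj₂ (a' , refl , q) =
    there (subst (_∈ elementsFrom (suc (o + g)) gs) (shift-+ o g a')
                 (∈-elementsFrom⁺ (suc (o + g)) a' gs q))

  ∈-elementsFrom⁻ : ∀ o x A → x ∈ elementsFrom o A → Σ ℕ λ a → x ≡ o + a × a ∈ˢ A
  ∈-elementsFrom⁻ o x (g ∷ gs) (here refl) = g , refl , memg-self g gs
  ∈-elementsFrom⁻ o x (g ∷ gs) (there m) with ∈-elementsFrom⁻ (suc (o + g)) x gs m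
  ... | a , refl , q = suc (g + a) , shift-+ o g a , subst T (sym (memg-shift g a gs)) q

  elementsFrom-unique : ∀ o A → Unique (elementsFrom o A)
  elementsFrom-unique o []       = []
  elementsFrom-unique o (g ∷ gs) = ¬Any⇒All¬ _ below ∷ elementsFrom-unique (suc (o + g)) gs
    where
    below : ¬ (o + g ∈ elementsFrom (suc (o + g)) gs)
    below m with ∈-elementsFrom⁻ (suc (o + g)) (o + g) gs m
    ... | a , e , _ = 1+n≰n (subst (suc (o + g) ≤_) (sym e) (m≤m+n (suc (o + g)) a))

∈-elements⁺ : ∀ {a} A → a ∈ˢ A → a ∈ elements A
∈-elements⁺ A p = ∈-elementsFrom⁺ 0 _ A p

∈-elements⁻ : ∀ {a} A → a ∈ elements A → a ∈ˢ A
∈-elements⁻ A m with ∈-elementsFrom⁻ 0 _ A m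
... | _ , refl , q = q

elements-unique : ∀ A → Unique (elements A)
elements-unique = elementsFrom-unique 0

infixl 6 _∪ˢ_
_∪ˢ_ : FinSub → FinSub → FinSub
A ∪ˢ B = foldr insert B (elements A)

private
  ∈-foldr-insertˡ : ∀ {a} B L → a ∈ L → a ∈ˢ foldr insert B L
  ∈-foldr-insertˡ B (x ∷ L) (here refl) = ins-here x (foldr insert B L)
  ∈-foldr-insertˡ B (x ∷ L) (there m)   = ins-there x _ (foldr insert B L) (∈-foldr-insertˡ B L m)

  ∈-foldr-insertʳ : ∀ {a} B L → a ∈ˢ B → a ∈ˢ foldr insert B L
  ∈-foldr-insertʳ B []      p = p
  ∈-foldr-insertʳ B (x ∷ L) p = ins-there x _ (foldr insert B L) (∈-foldr-insertʳ B L p)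

⊆-∪ˡ : ∀ A B → A ⊆ˢ A ∪ˢ B
⊆-∪ˡ A B a p = ∈-foldr-insertˡ B (elements A) (∈-elements⁺ A p)

⊆-∪ʳ : ∀ A B → B ⊆ˢ A ∪ˢ B
⊆-∪ʳ A B a p = ∈-foldr-insertʳ B (elements A) p

⊆-refl : ∀ A → A ⊆ˢ A
⊆-refl A a p = p

fresh : List ℕ → ℕ
fresh L = suc (sum L)

fresh-∉ : ∀ L → ¬ (fresh L ∈ L)
fresh-∉ L m = 1+n≰n (∈⇒≤sum m)
  where
  ∈⇒≤sum : ∀ {x L} → x ∈ L → x ≤ sum L
  ∈⇒≤sum {L = y ∷ L} (here refl) = m≤m+n y (sum L)
  ∈⇒≤sum {L = y ∷ L} (there m)   = ≤-trans (∈⇒≤sum m) (m≤n+m (sum L) y)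

fresh-≢ : ∀ {x} L → x ∈ L → x ≢ fresh L
fresh-≢ L m e = fresh-∉ L (subst (_∈ L) e m)

value : ∀ {A B} → Hom A B → (a : ℕ) → a ∈ˢ A → ℕ ⊎ 𝟚
value f a p with fun f a p
... | inj₁ (b , _) = inj₁ b
... | inj₂ i       = inj₂ i

infix 4 _≐_
_≐_ : ∀ {A B B'} → Hom A B → Hom A B' → Set
f ≐ g = ∀ a p → value f a p ≡ value g a p

value-ext : ∀ {A B} (f g : Hom A B) → f ≐ g → f ≈𝒞 g
value-ext {B = B} f g h a p with fun f a p | fun g a p | h a p
... | inj₁ d | inj₁ d' | e    = cong inj₁ (El-≡ B d d' (inj₁-injective e))
... | inj₂ i | inj₂ .i | refl = refl

value-irr : ∀ {A B} (f : Hom A B) a p q → value f a p ≡ value f a q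
value-irr f a p q = cong (value f a) (T-irrelevant p q)

value-resp : ∀ {A B} (f g : Hom A B) → f ≈𝒞 g → f ≐ g
value-resp f g h a p with fun f a p | fun g a p | h a p
... | _ | _ | refl = refl

value-inj₁ : ∀ {A B} (f : Hom A B) a p b → value f a p ≡ inj₁ b →
             Σ (b ∈ˢ B) λ q → fun f a p ≡ inj₁ (b , q)
value-inj₁ f a p b e with fun f a p
value-inj₁ f a p b refl | inj₁ (.b , q) = q , refl

value-injective : ∀ {A B} (f : Hom A B) a p a' p' b →
                  value f a p ≡ inj₁ b → value f a' p' ≡ inj₁ b → a ≡ a'
value-injective f a p a' p' b e e' with value-inj₁ f a p b e | value-inj₁ f a' p' b e'
... | q , h | q' , h' = f .inj a p a' p' (b , q) h (trans h' (cong (λ z → inj₁ (b , z)) (T-irrelevant q' q)))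

value-∘-inj₁ : ∀ {A B C} (f : Hom A B) (g : Hom B C) a p b r →
               value f a p ≡ inj₁ b → (∀ q → value g b q ≡ r) → value (g ∘𝒞 f) a p ≡ r
value-∘-inj₁ f g a p b r e h with fun f a p
value-∘-inj₁ f g a p b r refl h | inj₁ (.b , q) = h q

value-∘-inj₂ : ∀ {A B C} (f : Hom A B) (g : Hom B C) a p i →
               value f a p ≡ inj₂ i → value (g ∘𝒞 f) a p ≡ inj₂ i
value-∘-inj₂ f g a p i e with fun f a p
value-∘-inj₂ f g a p i refl | inj₂ .i = refl

value-fsub-≡ : ∀ A a i b p → b ≡ a → value (fsub A a i) b p ≡ inj₂ i
value-fsub-≡ A a i b p e with b ≟ a
... | yes _  = refl
... | no b≢a = ⊥-elim (b≢a e)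

value-fsub-≢ : ∀ A a i b p → b ≢ a → value (fsub A a i) b p ≡ inj₁ b
value-fsub-≢ A a i b p b≢a with b ≟ a
... | yes e = ⊥-elim (b≢a e)
... | no _  = refl

value-∘-fsub-≡ : ∀ {A C} a i (g : Hom (remove a A) C) b p → b ≡ a → value (g ∘𝒞 fsub A a i) b p ≡ inj₂ i
value-∘-fsub-≡ {A} a i g b p b≡a = value-∘-inj₂ (fsub A a i) g b p i (value-fsub-≡ A a i b p b≡a)

value-∘-fsub-≢ : ∀ {A C} a i (g : Hom (remove a A) C) b p q → b ≢ a →
                 value (g ∘𝒞 fsub A a i) b p ≡ value g b q
value-∘-fsub-≢ {A} a i g b p q b≢a =
  value-∘-inj₁ (fsub A a i) g b p b _ (value-fsub-≢ A a i b p b≢a) (λ q' → value-irr g b q' q)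

swap : ℕ → ℕ → ℕ → ℕ
swap x y z with z ≟ x
... | yes _ = y
... | no _ with z ≟ y
...   | yes _ = x
...   | no _  = z

swap-left : ∀ x y → swap x y x ≡ y
swap-left x y with x ≟ x
... | yes _ = refl
... | no x≢x = ⊥-elim (x≢x refl)

swap-right : ∀ x y → swap x y y ≡ x
swap-right x y with y ≟ x
... | yes e = e
... | no _ with y ≟ y
...   | yes _ = refl
...   | no y≢y = ⊥-elim (y≢y refl)

swap-other : ∀ x y z → z ≢ x → z ≢ y → swap x y z ≡ z
swap-other x y z z≢x z≢y with z ≟ x
... | yes e = ⊥-elim (z≢x e)
... | no _ with z ≟ y
...   | yes e = ⊥-elim (z≢y e)
...   | no _  = refl

swap-involutive : ∀ x y z → swap x y (swap x y z) ≡ z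
swap-involutive x y z with z ≟ x
... | yes refl = swap-right z y
... | no z≢x with z ≟ y
...   | yes refl = swap-left x z
...   | no z≢y   = swap-other x y z z≢x z≢y

swap-self : ∀ x z → swap x x z ≡ z
swap-self x z with z ≟ x
... | yes e = sym e
... | no _ with z ≟ x
...   | yes e = sym e
...   | no _  = refl

swapP : ℕ → ℕ → Perm
swapP x y = record
  { to = swap x y ; from = swap x y
  ; to-from = swap-involutive x y ; from-to = swap-involutive x y
  ; moved = x ∷ y ∷ []
  ; finite = λ a h → swap-other x y a (λ e → h (here e)) (λ e → h (there (here e))) }

invP : Perm → Perm
invP π = record
  { to = from π ; from = to π ; to-from = from-to π ; from-to = to-from π
  ; moved = moved π
  ; finite = λ a h → trans (cong (from π) (sym (finite π a h))) (from-to π a) }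

to-injective : ∀ (π : Perm) {a b} → to π a ≡ to π b → a ≡ b
to-injective π {a} {b} e = trans (sym (from-to π a)) (trans (cong (from π) e) (from-to π b))

extend : (ℕ → ℕ) → List ℕ → Perm
extend h []      = idP
extend h (d ∷ D) = swapP (h d) (to (extend h D) d) ∘P extend h D

extend-agrees : ∀ h D → (∀ {d d'} → d ∈ D → d' ∈ D → h d ≡ h d' → d ≡ d') →
                ∀ {d} → d ∈ D → to (extend h D) d ≡ h d
extend-agrees h (e ∷ D) inj {d} (here refl) = swap-right (h d) (to (extend h D) d)
extend-agrees h (e ∷ D) inj {d} (there m) with d ≟ e
... | yes refl = swap-right (h d) (to (extend h D) d)
... | no d≢e   = trans (cong (swap (h e) (to (extend h D) e)) ih)
                   (swap-other (h e) _ (h d) (λ x → d≢e (inj (there m) (here refl) x))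
                                             (λ x → d≢e (to-injective (extend h D) (trans ih x))))
  where
  ih : to (extend h D) d ≡ h d
  ih = extend-agrees h D (λ m m' → inj (there m) (there m')) m

extend-id : ∀ h D → (∀ {d} → d ∈ D → h d ≡ d) → ∀ a → to (extend h D) a ≡ a
extend-id h []      fix a = refl
extend-id h (e ∷ D) fix a
  rewrite extend-id h D (λ m → fix (there m)) a
        | extend-id h D (λ m → fix (there m)) e
        | fix (here refl) = swap-self e a

module Nominal (X : Raw01Sub) (N : IsNominal X) where
  open Raw01Sub X
  open IsNominal N
  module ≈ = IsEquivalence isEquivalence

  infixr 5 _⟨≈⟩_
  _⟨≈⟩_ : ∀ {x y z} → x ≈ y → y ≈ z → x ≈ z
  _⟨≈⟩_ = ≈.trans

  SupportedBy : (ℕ → Set) → Carrier → Set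
  SupportedBy P x = ∀ (π : Perm) → (∀ a → P a → to π a ≡ a) → act π x ≈ x

  supportedBy-resp : ∀ {P x y} → SupportedBy P x → x ≈ y → SupportedBy P y
  supportedBy-resp s e π h = act-cong π (≈.sym e) ⟨≈⟩ s π h ⟨≈⟩ e

  supportedBy-mono : ∀ {P Q : ℕ → Set} {x} → SupportedBy P x → (∀ d → P d → Q d) → SupportedBy Q x
  supportedBy-mono s P⇒Q π h = s π (λ a p → h a (P⇒Q a p))

  act-agree : ∀ {P y} (π σ : Perm) → SupportedBy P y → (∀ d → P d → to π d ≡ to σ d) →
              act π y ≈ act σ y
  act-agree {y = y} π σ s h = ≈.sym (
        act-ext σ (π ∘P (invP π ∘P σ)) (λ a → sym (to-from π (to σ a))) y
    ⟨≈⟩ act-comp π (invP π ∘P σ) y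
    ⟨≈⟩ act-cong π (s (invP π ∘P σ) (λ d p → trans (cong (from π) (sym (h d p))) (from-to π d))))

  supportedBy-act : ∀ {P Q : ℕ → Set} {y} (π : Perm) → SupportedBy P y → (∀ d → P d → Q (to π d)) →
                    SupportedBy Q (act π y)
  supportedBy-act {y = y} π s P⇒Qπ σ h =
    ≈.sym (act-comp σ π y) ⟨≈⟩ act-agree (σ ∘P π) π s (λ d p → h (to π d) (P⇒Qπ d p))

  -- With c fresh, the transposition τ = (a c) fixes y; π ∘ τ agrees with τ on P
  -- (π fixes c), hence π · y ≈ (π ∘ τ) · y ≈ τ · y ≈ y.
  supportedBy-fresh : ∀ A (P : ℕ → Set) {y} a → (∀ d → P d → d ∈ˢ A) → SupportedBy P y → a # y →
                      SupportedBy (λ d → P d × d ≢ a) y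
  supportedBy-fresh A P {y} a P⊆A s (C , sC , a∉C) π h =
    act-cong π (≈.sym τy) ⟨≈⟩ ≈.sym (act-comp π τ y) ⟨≈⟩ act-agree (π ∘P τ) τ s agree ⟨≈⟩ τy
    where
    L = a ∷ elements A ++ elements C ++ moved π
    c = fresh L
    c∉C : ¬ (c ∈ˢ C)
    c∉C p = fresh-≢ L (there (∈-++⁺ʳ (elements A) (∈-++⁺ˡ (∈-elements⁺ C p)))) refl
    P∌c : ∀ {d} → P d → d ≢ c
    P∌c p = fresh-≢ L (there (∈-++⁺ˡ (∈-elements⁺ A (P⊆A _ p))))
    πc : to π c ≡ c
    πc = finite π c (λ m → fresh-≢ L (there (∈-++⁺ʳ (elements A) (∈-++⁺ʳ (elements C) m))) refl)
    τ = swapP a c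
    τy : act τ y ≈ y
    τy = sC τ (λ d p → swap-other a c d (λ { refl → a∉C p }) (λ { refl → c∉C p }))
    agree : ∀ d → P d → to π (swap a c d) ≡ swap a c d
    agree d p = by-cases (d ≟ a)
      where
      by-cases : Dec (d ≡ a) → to π (swap a c d) ≡ swap a c d
      by-cases (yes refl) = trans (cong (to π) (swap-left d c)) (trans πc (sym (swap-left d c)))
      by-cases (no d≢a)   = trans (cong (to π) fixd) (trans (h d (p , d≢a)) (sym fixd))
        where
        fixd : swap a c d ≡ d
        fixd = swap-other a c d d≢a (P∌c p)

just≢nothing : ∀ {i : 𝟚} → just i ≢ nothing
just≢nothing ()

-- Partial substitutions σ : ℕ → Maybe 𝟚 substitute σ a for a where σ a is defined.
Within : (ℕ → Maybe 𝟚) → List ℕ → Set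
Within σ N = ∀ {a} → σ a ≢ nothing → a ∈ N

unset : (ℕ → Maybe 𝟚) → ℕ → ℕ → Maybe 𝟚
unset σ a d with d ≟ a
... | yes _ = nothing
... | no _  = σ d

unset-self : ∀ σ a → unset σ a a ≡ nothing
unset-self σ a with a ≟ a
... | yes _  = refl
... | no a≢a = ⊥-elim (a≢a refl)

unset-other : ∀ σ a d → d ≢ a → unset σ a d ≡ σ d
unset-other σ a d d≢a with d ≟ a
... | yes e = ⊥-elim (d≢a e)
... | no _  = refl

restrictTo : ∀ {P : ℕ → Set} → (∀ d → Dec (P d)) → (ℕ → Maybe 𝟚) → ℕ → Maybe 𝟚
restrictTo P? σ d with P? d
... | yes _ = σ d
... | no _  = nothing

restrictTo-∈ : ∀ {P : ℕ → Set} (P? : ∀ d → Dec (P d)) σ {d} → P d → restrictTo P? σ d ≡ σ d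
restrictTo-∈ P? σ {d} Pd with P? d
... | yes _ = refl
... | no ¬Pd = ⊥-elim (¬Pd Pd)

restrictTo-defined : ∀ {P : ℕ → Set} (P? : ∀ d → Dec (P d)) σ {d} → restrictTo P? σ d ≢ nothing → P d
restrictTo-defined P? σ {d} defined with P? d
... | yes Pd = Pd
... | no _   = ⊥-elim (defined refl)

module Substitution (X : Raw01Sub) (S : Is01Sub X) where
  open Raw01Sub X
  open Is01Sub S
  open IsNominal isNominal
  open Nominal X isNominal public

  sub? : Carrier → ℕ → Maybe 𝟚 → Carrier
  sub? y a nothing  = y
  sub? y a (just i) = sub y a i

  subAll : Carrier → List ℕ → (ℕ → Maybe 𝟚) → Carrier
  subAll y []      σ = y
  subAll y (a ∷ N) σ = subAll (sub? y a (σ a)) N σ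

  sub?-cong : ∀ {x y} a m → x ≈ y → sub? x a m ≈ sub? y a m
  sub?-cong a nothing  e = e
  sub?-cong a (just i) e = sub-cong a i e

  sub?-comm : ∀ y a b m m' → a ≢ b → sub? (sub? y a m) b m' ≈ sub? (sub? y b m') a m
  sub?-comm y a b nothing  nothing   a≢b = ≈.refl
  sub?-comm y a b nothing  (just _)  a≢b = ≈.refl
  sub?-comm y a b (just _) nothing   a≢b = ≈.refl
  sub?-comm y a b (just i) (just i') a≢b = sub-comm y a b i i' a≢b

  sub?-twice : ∀ y a m m' → m ≡ nothing ⊎ m' ≡ nothing → sub? (sub? y a m) a m' ≡ sub? y a (m <∣> m')
  sub?-twice y a nothing  m'       _         = refl
  sub?-twice y a (just i) nothing  _         = refl
  sub?-twice y a (just i) (just j) (inj₁ ())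
  sub?-twice y a (just i) (just j) (inj₂ ())

  subAll-cong : ∀ {x y} N σ → x ≈ y → subAll x N σ ≈ subAll y N σ
  subAll-cong []      σ e = e
  subAll-cong (a ∷ N) σ e = subAll-cong N σ (sub?-cong a (σ a) e)

  subAll-ext : ∀ y N σ σ' → (∀ {a} → a ∈ N → σ a ≡ σ' a) → subAll y N σ ≡ subAll y N σ'
  subAll-ext y []      σ σ' h = refl
  subAll-ext y (a ∷ N) σ σ' h rewrite h (here refl) = subAll-ext _ N σ σ' (λ m → h (there m))

  subAll-nothing : ∀ y N σ → (∀ {a} → a ∈ N → σ a ≡ nothing) → subAll y N σ ≡ y
  subAll-nothing y []      σ h = refl
  subAll-nothing y (a ∷ N) σ h rewrite h (here refl) = subAll-nothing y N σ (λ m → h (there m))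

  sub?-subAll : ∀ y a m N σ → ¬ (a ∈ N) → sub? (subAll y N σ) a m ≈ subAll (sub? y a m) N σ
  sub?-subAll y a m []      σ a∉N = ≈.refl
  sub?-subAll y a m (b ∷ N) σ a∉N =
    sub?-subAll (sub? y b (σ b)) a m N σ (λ x → a∉N (there x))
    ⟨≈⟩ subAll-cong N σ (sub?-comm y b a (σ b) m (λ e → a∉N (here (sym e))))

  subAll-unset : ∀ y a N σ → ¬ (a ∈ N) → subAll y N σ ≡ subAll y N (unset σ a)
  subAll-unset y a N σ a∉N =
    subAll-ext y N σ (unset σ a) (λ m → sym (unset-other σ a _ (λ { refl → a∉N m })))

  subAll-pull : ∀ y N σ {a} → a ∈ N → Unique N → subAll y N σ ≈ subAll (sub? y a (σ a)) N (unset σ a)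
  subAll-pull y (b ∷ N) σ (here refl) (b∉ ∷ U) rewrite unset-self σ b =
    ≈.reflexive (subAll-unset _ b N σ (All¬⇒¬Any b∉))
  subAll-pull y (b ∷ N) σ {a} (there m) (b∉ ∷ U)
    rewrite unset-other σ a b (λ { refl → All¬⇒¬Any b∉ m }) =
      subAll-pull (sub? y b (σ b)) N σ m U
      ⟨≈⟩ subAll-cong N (unset σ a) (sub?-comm y b a (σ b) (σ a) (λ { refl → All¬⇒¬Any b∉ m }))

  subAll-reorder : ∀ y N M σ → Unique N → Unique M → Within σ N → Within σ M →
                   subAll y N σ ≈ subAll y M σ
  subAll-reorder y [] M σ UN UM σ⊆N σ⊆M =
    ≈.reflexive (sym (subAll-nothing y M σ λ {a} _ → undefined a))
    where
    undefined : ∀ a → σ a ≡ nothing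
    undefined a with σ a in e
    ... | nothing = refl
    ... | just _ with () ← σ⊆N {a} (λ e' → just≢nothing (trans (sym e) e'))
  subAll-reorder y (a ∷ N) M σ (a∉ ∷ UN) UM σ⊆N σ⊆M with σ a in e
  ... | nothing = subAll-reorder y N M σ UN UM σ⊆N' σ⊆M
    where
    σ⊆N' : Within σ N
    σ⊆N' {d} d∈σ with σ⊆N d∈σ
    ... | here refl = ⊥-elim (d∈σ e)
    ... | there m   = m
  ... | just i =
        ≈.reflexive (subAll-unset (sub y a i) a N σ (All¬⇒¬Any a∉))
    ⟨≈⟩ subAll-reorder (sub y a i) N M (unset σ a) UN UM unset⊆N unset⊆M
    ⟨≈⟩ ≈.sym (subst (λ z → subAll y M σ ≈ subAll (sub? y a z) M (unset σ a)) e
                     (subAll-pull y M σ (σ⊆M (λ e' → just≢nothing (trans (sym e) e'))) UM))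
    where
    unset⊆M : Within (unset σ a) M
    unset⊆M {d} d∈σ with d ≟ a
    ... | yes _ = ⊥-elim (d∈σ refl)
    ... | no _  = σ⊆M d∈σ
    unset⊆N : Within (unset σ a) N
    unset⊆N {d} d∈σ with d ≟ a
    ... | yes _ = ⊥-elim (d∈σ refl)
    ... | no d≢a with σ⊆N d∈σ
    ...   | here d≡a = ⊥-elim (d≢a d≡a)
    ...   | there m = m

  subAll-merge : ∀ y N σ τ → Unique N → (∀ a → σ a ≡ nothing ⊎ τ a ≡ nothing) →
                 subAll (subAll y N σ) N τ ≈ subAll y N (λ a → σ a <∣> τ a)
  subAll-merge y []      σ τ U disjoint = ≈.refl
  subAll-merge y (a ∷ N) σ τ (a∉ ∷ U) disjoint =
    subAll-cong N τ (sub?-subAll (sub? y a (σ a)) a (τ a) N σ (All¬⇒¬Any a∉))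
    ⟨≈⟩ subAll-merge _ N σ τ U disjoint
    ⟨≈⟩ ≈.reflexive (cong (λ z → subAll z N _) (sub?-twice y a (σ a) (τ a) (disjoint a)))

  subAll-act : ∀ (π : Perm) y M σ → subAll (act π y) M σ ≈ act π (subAll y (lmap (from π) M) (σ ∘ to π))
  subAll-act π y []      σ = ≈.refl
  subAll-act π y (b ∷ M) σ = subAll-cong M σ step ⟨≈⟩ subAll-act π _ M σ
    where
    equivariant : ∀ m → sub? (act π y) b m ≈ act π (sub? y (from π b) m)
    equivariant nothing  = ≈.refl
    equivariant (just i) =
      ≈.sym (subst (λ z → act π (sub y (from π b) i) ≈ sub (act π y) z i) (to-from π b)
                   (sub-equiv π y (from π b) i))
    step : sub? (act π y) b (σ b) ≈ act π (sub? y (from π b) (σ (to π (from π b))))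
    step = subst (λ z → sub? (act π y) b (σ b) ≈ act π (sub? y (from π b) (σ z)))
                 (sym (to-from π b)) (equivariant (σ b))

  sub-trivial : ∀ (P : ℕ → Set) A {y} a i → (∀ d → P d → d ∈ˢ A) → SupportedBy P y → ¬ P a →
                sub y a i ≈ y
  sub-trivial P A {y} a i P⊆A s ¬Pa = fresh-sub y a i (remove a A , s' , ∉-remove a A)
    where
    s' : Supports (remove a A) y
    s' = supportedBy-mono s (λ d p → rem-mem a d A (P⊆A d p) (λ { refl → ¬Pa p }))

  sub-supportedBy : ∀ (P : ℕ → Set) A {y} a i → (∀ d → P d → d ∈ˢ A) → SupportedBy P y → Dec (P a) →
                    SupportedBy P (sub y a i)
  sub-supportedBy P A {y} a i P⊆A s (yes Pa) π h =
    sub-equiv π y a i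
    ⟨≈⟩ ≈.reflexive (cong (λ z → sub (act π y) z i) (h a Pa))
    ⟨≈⟩ sub-cong a i (s π h)
  sub-supportedBy P A {y} a i P⊆A s (no ¬Pa) = supportedBy-resp s (≈.sym (sub-trivial P A a i P⊆A s ¬Pa))

  sub?-supportedBy : ∀ (P : ℕ → Set) A {y} a m → (∀ d → P d → d ∈ˢ A) → SupportedBy P y → Dec (P a) →
                     SupportedBy P (sub? y a m)
  sub?-supportedBy P A a nothing  P⊆A s Pa? = s
  sub?-supportedBy P A a (just i) P⊆A s Pa? = sub-supportedBy P A a i P⊆A s Pa?

  subAll-trivial : ∀ (P : ℕ → Set) A y N σ → (∀ d → P d → d ∈ˢ A) → SupportedBy P y →
                   (∀ {a} → a ∈ N → σ a ≢ nothing → ¬ P a) → subAll y N σ ≈ y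
  subAll-trivial P A y []      σ P⊆A s outside = ≈.refl
  subAll-trivial P A y (a ∷ N) σ P⊆A s outside =
    subAll-trivial P A _ N σ P⊆A (supportedBy-resp s (≈.sym first)) (λ m → outside (there m)) ⟨≈⟩ first
    where
    trivial : ∀ m → σ a ≡ m → sub? y a m ≈ y
    trivial nothing  _  = ≈.refl
    trivial (just i) e = sub-trivial P A a i P⊆A s (outside (here refl) (λ e' → just≢nothing (trans (sym e) e')))
    first : sub? y a (σ a) ≈ y
    first = trivial (σ a) refl

  -- By axiom (i), every substituted name leaves the support.
  subAll-supportedBy : ∀ (P : ℕ → Set) A y N σ → (∀ d → P d → d ∈ˢ A) → (∀ d → Dec (P d)) →
                       SupportedBy P y → SupportedBy (λ d → P d × (d ∈ N → σ d ≡ nothing)) (subAll y N σ)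
  subAll-supportedBy P A y [] σ P⊆A P? s = supportedBy-mono s (λ d p → p , λ ())
  subAll-supportedBy P A y (a ∷ N) σ P⊆A P? s with σ a in e
  ... | nothing = supportedBy-mono (subAll-supportedBy P A y N σ P⊆A P? s)
                    (λ { d (p , h) → p , λ { (here refl) → e ; (there m) → h m } })
  ... | just i  = supportedBy-mono (subAll-supportedBy P' A (sub y a i) N σ P'⊆A P'? s')
                    (λ { d ((p , d≢a) , h) → p , λ { (here d≡a) → ⊥-elim (d≢a d≡a) ; (there m) → h m } })
    where
    P' : ℕ → Set
    P' d = P d × d ≢ a
    P'⊆A : ∀ d → P' d → d ∈ˢ A
    P'⊆A d (p , _) = P⊆A d p
    P'? : ∀ d → Dec (P' d)
    P'? d = P? d ×-dec ¬? (d ≟ a)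
    s' : SupportedBy P' (sub y a i)
    s' = supportedBy-fresh A P a P⊆A (sub-supportedBy P A a i P⊆A s (P? a)) (sub-fresh y a i)

  subAll-restrict : ∀ (P : ℕ → Set) A y N σ (P? : ∀ d → Dec (P d)) → (∀ d → P d → d ∈ˢ A) →
                    SupportedBy P y → subAll y N σ ≈ subAll y N (restrictTo P? σ)
  subAll-restrict P A y []      σ P? P⊆A s = ≈.refl
  subAll-restrict P A y (a ∷ N) σ P? P⊆A s =
    subAll-restrict P A _ N σ P? P⊆A (sub?-supportedBy P A a (σ a) P⊆A s (P? a))
    ⟨≈⟩ subAll-cong N (restrictTo P? σ) first
    where
    first : sub? y a (σ a) ≈ sub? y a (restrictTo P? σ a)
    first with P? a
    ... | yes _  = ≈.refl
    ... | no ¬Pa with σ a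
    ...   | nothing = ≈.refl
    ...   | just i  = sub-trivial P A a i P⊆A s ¬Pa

-- I* F is a 01-substitution set

value-incl-∘ : ∀ {A B} C (s : B ⊆ˢ C) (f : Hom A B) a p → value (incl {B} {C} s ∘𝒞 f) a p ≡ value f a p
value-incl-∘ C s f a p with fun f a p
... | inj₁ _ = refl
... | inj₂ _ = refl

fsub-via-swap : ∀ {A B} a c i → (∀ {d} → d ∈ˢ A → d ≢ c) → (s : image (swap a c) A ⊆ˢ B) →
                fsub A a i ≐ fsub B c i ∘𝒞 (incl s ∘𝒞 restrict (swapP a c) A)
fsub-via-swap {A} {B} a c i A∌c s b p = by-cases (b ≟ a)
  where
  q = s (swap a c b) (image-mem (swap a c) b A p)
  by-cases : Dec (b ≡ a) → value (fsub A a i) b p ≡ value (fsub B c i) (swap a c b) q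
  by-cases (yes refl) = trans (value-fsub-≡ A b i b p refl) (sym (value-fsub-≡ B c i _ q (swap-left b c)))
  by-cases (no b≢a)   = trans (value-fsub-≢ A a i b p b≢a)
    (sym (trans (value-fsub-≢ B c i _ q (λ e → A∌c p (trans (sym τb) e))) (cong inj₁ τb)))
    where
    τb : swap a c b ≡ b
    τb = swap-other a c b b≢a (A∌c p)

module I*Structure (F : Presheaf) where
  open Presheaf F
  open Raw01Sub (I* F)
  module FB (B : FinSub) = Setoid (obj B)

  map-≐ : ∀ {A B C} {h : Hom A C} (f : Hom A B) (g : Hom B C) x → h ≐ g ∘𝒞 f →
          map h x ≈[ C ] map g (map f x)
  map-≐ {C = C} {h} f g x e = FB.trans C (map-resp (value-ext h (g ∘𝒞 f) e) x) (map-∘ f g x)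

  incl-∘ : ∀ A B C (s : A ⊆ˢ B) (t : B ⊆ˢ C) (u : A ⊆ˢ C) x →
           map (incl {A} {C} u) x ≈[ C ] map (incl {B} {C} t) (map (incl {A} {B} s) x)
  incl-∘ A B C s t u x = map-≐ (incl s) (incl t) x (λ a p → refl)

  ≈-at : ∀ {B x y} → x ≈[ B ] y → (B , x) ≈ (B , y)
  ≈-at {B} e = B , ⊆-refl B , ⊆-refl B , map-cong (incl (⊆-refl B)) e

  ≈-refl : ∀ {u} → u ≈ u
  ≈-refl {A , x} = ≈-at {A} (FB.refl A)

  ≈-sym : ∀ {u v} → u ≈ v → v ≈ u
  ≈-sym (B , s , s' , e) = B , s' , s , FB.sym B e

  ≈-trans : ∀ {u v w} → u ≈ v → v ≈ w → u ≈ w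
  ≈-trans {A , x} {A' , x'} {A'' , x''} (B , s , s' , e) (B' , t , t' , e') = C , u , u'' , chain
    where
    C = B ∪ˢ B'
    l : B ⊆ˢ C
    l = ⊆-∪ˡ B B'
    r : B' ⊆ˢ C
    r = ⊆-∪ʳ B B'
    u : A ⊆ˢ C
    u a p = l a (s a p)
    u' : A' ⊆ˢ C
    u' a p = l a (s' a p)
    u'' : A'' ⊆ˢ C
    u'' a p = r a (t' a p)
    open SetoidReasoning (obj C)
    chain : map (incl {A} {C} u) x ≈[ C ] map (incl {A''} {C} u'') x''
    chain = begin
      map (incl u) x                                   ≈⟨ incl-∘ A B C s l u x ⟩
      map (incl l) (map (incl {A} {B} s) x)            ≈⟨ map-cong (incl l) e ⟩
      map (incl l) (map (incl {A'} {B} s') x')         ≈⟨ incl-∘ A' B C s' l u' x' ⟨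
      map (incl u') x'                                 ≈⟨ incl-∘ A' B' C t r u' x' ⟩
      map (incl r) (map (incl {A'} {B'} t) x')         ≈⟨ map-cong (incl r) e' ⟩
      map (incl r) (map (incl {A''} {B'} t') x'')      ≈⟨ incl-∘ A'' B' C t' r u'' x'' ⟨
      map (incl u'') x''                               ∎

  infixr 5 _⟨~⟩_
  _⟨~⟩_ : ∀ {u v w} → u ≈ v → v ≈ w → u ≈ w
  _⟨~⟩_ = ≈-trans

  ≐⇒≈ : ∀ {A B B'} (f : Hom A B) (f' : Hom A B') x → f ≐ f' → (B , map f x) ≈ (B' , map f' x)
  ≐⇒≈ {A} {B} {B'} f f' x e = C , l , r , chain
    where
    C = B ∪ˢ B'
    l : B ⊆ˢ C
    l = ⊆-∪ˡ B B'
    r : B' ⊆ˢ C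
    r = ⊆-∪ʳ B B'
    open SetoidReasoning (obj C)
    ιl : Hom B C
    ιl = incl l
    ιr : Hom B' C
    ιr = incl r
    chain : map ιl (map f x) ≈[ C ] map ιr (map f' x)
    chain = begin
      map ιl (map f x)   ≈⟨ map-∘ f ιl x ⟨
      map (ιl ∘𝒞 f) x    ≈⟨ map-resp (value-ext (ιl ∘𝒞 f) (ιr ∘𝒞 f') same) x ⟩
      map (ιr ∘𝒞 f') x   ≈⟨ map-∘ f' ιr x ⟩
      map ιr (map f' x)  ∎
      where
      same : ιl ∘𝒞 f ≐ ιr ∘𝒞 f'
      same a p = trans (value-incl-∘ C l f a p) (trans (e a p) (sym (value-incl-∘ C r f' a p)))

  ≐∘⇒≈ : ∀ {A B B' C} (f : Hom A B) (h : Hom A C) (g : Hom C B') x →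
          f ≐ g ∘𝒞 h → (B , map f x) ≈ (B' , map g (map h x))
  ≐∘⇒≈ f h g x e = ≐⇒≈ f (g ∘𝒞 h) x e ⟨~⟩ ≈-at (map-∘ h g x)

  ∘≐∘⇒≈ : ∀ {A B B' C C'} (f : Hom A C) (k : Hom C B) (h : Hom A C') (g : Hom C' B') x →
           k ∘𝒞 f ≐ g ∘𝒞 h → (B , map k (map f x)) ≈ (B' , map g (map h x))
  ∘≐∘⇒≈ {B = B} f k h g x e = ≈-at (FB.sym B (map-∘ f k x)) ⟨~⟩ ≐∘⇒≈ (k ∘𝒞 f) h g x e

  ≈-map-id : ∀ {A} x → (A , x) ≈ (A , map id𝒞 x)
  ≈-map-id {A} x = ≈-at (FB.sym A (map-id x))

  supports-stage : ∀ A x → Supports A (A , x)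
  supports-stage A x π fix = ≈-sym (≈-map-id x ⟨~⟩ ≐⇒≈ id𝒞 (restrict π A) x (λ a p → cong inj₁ (sym (fix a p))))

  map-respects-≈ : (T : FinSub → FinSub) (k : ∀ A → Hom A (T A)) →
                   (∀ {A D} (s : A ⊆ˢ D) → k A ≐ k D ∘𝒞 incl s) →
                   ∀ {A A' x x'} → (A , x) ≈ (A' , x') → (T A , map (k A) x) ≈ (T A' , map (k A') x')
  map-respects-≈ T k natural {A} {A'} {x} {x'} (D , s , s' , e) =
    ≐∘⇒≈ (k A) (incl s) (k D) x (natural s)
    ⟨~⟩ ≈-at (map-cong (k D) e)
    ⟨~⟩ ≈-sym (≐∘⇒≈ (k A') (incl s') (k D) x' (natural s'))

  fsub-incl : ∀ a i {A D} (s : A ⊆ˢ D) → fsub A a i ≐ fsub D a i ∘𝒞 incl s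
  fsub-incl a i {A} {D} s b p = by-cases (b ≟ a)
    where
    by-cases : Dec (b ≡ a) → value (fsub A a i) b p ≡ value (fsub D a i) b (s b p)
    by-cases (yes b≡a) = trans (value-fsub-≡ A a i b p b≡a) (sym (value-fsub-≡ D a i b (s b p) b≡a))
    by-cases (no b≢a)  = trans (value-fsub-≢ A a i b p b≢a) (sym (value-fsub-≢ D a i b (s b p) b≢a))

  sub-equivariant : ∀ π u a i → act π (sub u a i) ≈ sub (act π u) (to π a) i
  sub-equivariant π (A , x) a i =
    ∘≐∘⇒≈ (fsub A a i) (restrict π (remove a A)) (restrict π A) (fsub (image (to π) A) (to π a) i) x agree
    where
    agree : restrict π (remove a A) ∘𝒞 fsub A a i ≐ fsub (image (to π) A) (to π a) i ∘𝒞 restrict π A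
    agree b p = by-cases (b ≟ a)
      where
      πb∈ = image-mem (to π) b A p
      by-cases : Dec (b ≡ a) → value (restrict π (remove a A) ∘𝒞 fsub A a i) b p
                              ≡ value (fsub (image (to π) A) (to π a) i) (to π b) πb∈
      by-cases (yes b≡a) = trans (value-∘-fsub-≡ a i _ b p b≡a)
                                 (sym (value-fsub-≡ _ (to π a) i (to π b) πb∈ (cong (to π) b≡a)))
      by-cases (no b≢a)  = trans (value-∘-fsub-≢ a i _ b p (rem-mem a b A p b≢a) b≢a)
                                 (sym (value-fsub-≢ _ (to π a) i (to π b) πb∈ (λ e → b≢a (to-injective π e))))

  sub-commutes : ∀ u a a' i i' → a ≢ a' → sub (sub u a i) a' i' ≈ sub (sub u a' i') a i
  sub-commutes (A , x) a a' i i' a≢a' =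
    ∘≐∘⇒≈ (fsub A a i) (fsub (remove a A) a' i') (fsub A a' i') (fsub (remove a' A) a i) x agree
    where
    agree : fsub (remove a A) a' i' ∘𝒞 fsub A a i ≐ fsub (remove a' A) a i ∘𝒞 fsub A a' i'
    agree b p = by-cases (b ≟ a) (b ≟ a')
      where
      by-cases : Dec (b ≡ a) → Dec (b ≡ a') → value (fsub (remove a A) a' i' ∘𝒞 fsub A a i) b p
                                             ≡ value (fsub (remove a' A) a i ∘𝒞 fsub A a' i') b p
      by-cases (yes b≡a) (yes b≡a') = ⊥-elim (a≢a' (trans (sym b≡a) b≡a'))
      by-cases (yes b≡a) (no b≢a')  =
        trans (value-∘-fsub-≡ a i _ b p b≡a)
              (sym (trans (value-∘-fsub-≢ a' i' _ b p q' b≢a') (value-fsub-≡ _ a i b q' b≡a)))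
        where q' = rem-mem a' b A p b≢a'
      by-cases (no b≢a)  (yes b≡a') =
        trans (trans (value-∘-fsub-≢ a i _ b p q b≢a) (value-fsub-≡ _ a' i' b q b≡a'))
              (sym (value-∘-fsub-≡ a' i' _ b p b≡a'))
        where q = rem-mem a b A p b≢a
      by-cases (no b≢a)  (no b≢a')  =
        trans (trans (value-∘-fsub-≢ a i _ b p q b≢a) (value-fsub-≢ _ a' i' b q b≢a'))
              (sym (trans (value-∘-fsub-≢ a' i' _ b p q' b≢a') (value-fsub-≢ _ a i b q' b≢a)))
        where
        q  = rem-mem a b A p b≢a
        q' = rem-mem a' b A p b≢a'

  -- For c fresh, the transposition τ = (a c) fixes (A , x) and turns a := i into c := i.
  sub-fresh-trivial : ∀ u a i → a # u → sub u a i ≈ u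
  sub-fresh-trivial (A , x) a i (C , sC , a∉C) = conclude (sC τ τ-fixes-C)
    where
    L = a ∷ elements A ++ elements C
    c = fresh L
    τ = swapP a c
    τ-fixes-C : ∀ d → d ∈ˢ C → swap a c d ≡ d
    τ-fixes-C d p = swap-other a c d (λ { refl → a∉C p })
                      (λ { refl → fresh-≢ L (there (∈-++⁺ʳ (elements A) (∈-elements⁺ C p))) refl })
    A∌c : ∀ {d} → d ∈ˢ A → d ≢ c
    A∌c p = fresh-≢ L (there (∈-++⁺ˡ (∈-elements⁺ A p)))
    conclude : act τ (A , x) ≈ (A , x) → sub (A , x) a i ≈ (A , x)
    conclude (B , s , s' , e) = B' , t , t' , chain
      where
      B' = remove c B
      t' : A ⊆ˢ B'
      t' d p = rem-mem c d B (s' d p) (A∌c p)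
      t : remove a A ⊆ˢ B'
      t d p = t' d (proj₁ (∈-remove⁻ a d A p))
      ι : Hom (remove a A) B'
      ι = incl t
      ι' : Hom A B'
      ι' = incl t'
      fixed : Hom A B
      fixed = incl s'
      swapped : Hom A B
      swapped = incl s ∘𝒞 restrict τ A
      after-swap : ι ∘𝒞 fsub A a i ≐ fsub B c i ∘𝒞 swapped
      after-swap b p = trans (value-incl-∘ B' t (fsub A a i) b p) (fsub-via-swap a c i A∌c s b p)
      unswapped : ι' ≐ fsub B c i ∘𝒞 fixed
      unswapped b p = sym (value-fsub-≢ B c i b (s' b p) (A∌c p))
      open SetoidReasoning (obj B')
      chain : map ι (map (fsub A a i) x) ≈[ B' ] map ι' x
      chain = begin
        map ι (map (fsub A a i) x)                            ≈⟨ map-∘ (fsub A a i) ι x ⟨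
        map (ι ∘𝒞 fsub A a i) x                               ≈⟨ map-≐ swapped (fsub B c i) x after-swap ⟩
        map (fsub B c i) (map swapped x)                      ≈⟨ map-cong (fsub B c i) (map-∘ (restrict τ A) (incl s) x) ⟩
        map (fsub B c i) (map (incl s) (map (restrict τ A) x)) ≈⟨ map-cong (fsub B c i) e ⟩
        map (fsub B c i) (map fixed x)                        ≈⟨ map-≐ fixed (fsub B c i) x unswapped ⟨
        map ι' x                                              ∎

  isNominal : IsNominal (I* F)
  isNominal = record
    { isEquivalence = record { refl = ≈-refl ; sym = ≈-sym ; trans = ≈-trans }
    ; act-cong = λ π → map-respects-≈ (image (to π)) (restrict π) (λ s a p → refl)
    ; act-ext  = λ { π σ h (A , x) → ≐⇒≈ (restrict π A) (restrict σ A) x (λ a p → cong inj₁ (h a)) }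
    ; act-id   = λ { (A , x) → ≐⇒≈ (restrict idP A) id𝒞 x (λ a p → refl) ⟨~⟩ ≈-sym (≈-map-id x) }
    ; act-comp = λ { π σ (A , x) → ≐∘⇒≈ (restrict (π ∘P σ) A) (restrict σ A) (restrict π (image (to σ) A)) x
                                         (λ a p → refl) }
    ; finsupp  = λ { (A , x) → A , supports-stage A x }
    }

  is01Sub : Is01Sub (I* F)
  is01Sub = record
    { isNominal = isNominal
    ; sub-cong  = λ a i → map-respects-≈ (remove a) (λ A → fsub A a i) (fsub-incl a i)
    ; sub-equiv = sub-equivariant
    ; sub-fresh = λ { (A , x) a i → remove a A , supports-stage (remove a A) (map (fsub A a i) x) , ∉-remove a A }
    ; fresh-sub = sub-fresh-trivial
    ; sub-comm  = sub-commutes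
    }

-- Factorisation of the morphisms of 𝒞

valueAt : ∀ {A B} → Hom A B → ℕ → Maybe (ℕ ⊎ 𝟚)
valueAt {A} f a with a ∈ˢ? A
... | yes p = just (value f a p)
... | no _  = nothing

valueAt-∈ : ∀ {A B} (f : Hom A B) a p → valueAt f a ≡ just (value f a p)
valueAt-∈ {A} f a p with a ∈ˢ? A
... | yes q = cong just (value-irr f a q p)
... | no a∉ = ⊥-elim (a∉ p)

valueAt-∉ : ∀ {A B} (f : Hom A B) a → ¬ (a ∈ˢ A) → valueAt f a ≡ nothing
valueAt-∉ {A} f a a∉ with a ∈ˢ? A
... | yes p = ⊥-elim (a∉ p)
... | no _  = refl

constant : ℕ ⊎ 𝟚 → Maybe 𝟚
constant (inj₁ _) = nothing
constant (inj₂ i) = just i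

renames : ℕ ⊎ 𝟚 → Bool
renames (inj₁ _) = true
renames (inj₂ _) = false

renamedTo : ℕ → ℕ ⊎ 𝟚 → ℕ
renamedTo a (inj₁ b) = b
renamedTo a (inj₂ _) = a

-- Every f ∈ 𝒞(A, B) factors as the substitutions substPart f followed by
-- the renaming of the remaining names, extended to a permutation renamingPart f.
substPart : ∀ {A B} → Hom A B → ℕ → Maybe 𝟚
substPart f a = valueAt f a >>= constant

renamedDomain : ∀ {A B} → Hom A B → List ℕ
renamedDomain {A} f = filter (λ a → T? (maybe′ renames false (valueAt f a))) (elements A)

renamingPart : ∀ {A B} → Hom A B → Perm
renamingPart f = extend (λ a → maybe′ (renamedTo a) a (valueAt f a)) (renamedDomain f)

substPart-∈ : ∀ {A B} (f : Hom A B) a p → substPart f a ≡ constant (value f a p)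
substPart-∈ f a p = cong (_>>= constant) (valueAt-∈ f a p)

substPart-∉ : ∀ {A B} (f : Hom A B) a → ¬ (a ∈ˢ A) → substPart f a ≡ nothing
substPart-∉ f a a∉ = cong (_>>= constant) (valueAt-∉ f a a∉)

substPart-resp : ∀ {A B} (f g : Hom A B) → f ≈𝒞 g → ∀ a → substPart f a ≡ substPart g a
substPart-resp {A} f g f≈g a = by-cases (a ∈ˢ? A)
  where
  by-cases : Dec (a ∈ˢ A) → substPart f a ≡ substPart g a
  by-cases (yes p) = trans (substPart-∈ f a p) (trans (cong constant (value-resp f g f≈g a p)) (sym (substPart-∈ g a p)))
  by-cases (no a∉) = trans (substPart-∉ f a a∉) (sym (substPart-∉ g a a∉))

substPart-nothing : ∀ {A B} (f : Hom A B) a p → substPart f a ≡ nothing → Σ ℕ λ b → value f a p ≡ inj₁ b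
substPart-nothing f a p e with value f a p in eq
... | inj₁ b = b , refl
... | inj₂ i = ⊥-elim (just≢nothing (trans (sym (cong constant eq)) (trans (sym (substPart-∈ f a p)) e)))

private
  ∈-renamedDomain⁻ : ∀ {A B} (f : Hom A B) {a} → a ∈ renamedDomain f →
                     Σ (a ∈ˢ A) λ p → value f a p ≡ inj₁ (maybe′ (renamedTo a) a (valueAt f a))
  ∈-renamedDomain⁻ {A} f {a} m with ∈-filter⁻ (λ a → T? (maybe′ renames false (valueAt f a))) m
  ... | m' , r with p ← ∈-elements⁻ A m' rewrite valueAt-∈ f a p = p , renamed (value f a p) r
    where
    renamed : ∀ v → T (renames v) → v ≡ inj₁ (renamedTo a v)
    renamed (inj₁ b) _ = refl

  ∈-renamedDomain⁺ : ∀ {A B} (f : Hom A B) {a} p b → value f a p ≡ inj₁ b →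
                     a ∈ renamedDomain f × maybe′ (renamedTo a) a (valueAt f a) ≡ b
  ∈-renamedDomain⁺ {A} f {a} p b e rewrite valueAt-∈ f a p | e =
    ∈-filter⁺ (λ a → T? (maybe′ renames false (valueAt f a))) (∈-elements⁺ A p)
              (subst (T ∘ maybe′ renames false) (sym (trans (valueAt-∈ f a p) (cong just e))) tt) , refl

renamingPart-value : ∀ {A B} (f : Hom A B) a p b → value f a p ≡ inj₁ b → to (renamingPart f) a ≡ b
renamingPart-value f a p b e with ∈-renamedDomain⁺ f p b e
... | m , target≡b = trans (extend-agrees _ (renamedDomain f) injective m) target≡b
  where
  injective : ∀ {d d'} → d ∈ renamedDomain f → d' ∈ renamedDomain f → _ → d ≡ d'
  injective m m' e' with ∈-renamedDomain⁻ f m | ∈-renamedDomain⁻ f m'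
  ... | p , h | p' , h' = value-injective f _ p _ p' _ h (trans h' (cong inj₁ (sym e')))

renamingPart-id : ∀ {A B} (f : Hom A B) → (∀ a p b → value f a p ≡ inj₁ b → b ≡ a) →
                  ∀ a → to (renamingPart f) a ≡ a
renamingPart-id f keeps = extend-id _ (renamedDomain f) fixes
  where
  fixes : ∀ {d} → d ∈ renamedDomain f → _
  fixes m with ∈-renamedDomain⁻ f m
  ... | p , h = keeps _ p _ h

Renamed : ∀ {A B} → Hom A B → ℕ → Set
Renamed {A} f d = d ∈ˢ A × substPart f d ≡ nothing

renamed? : ∀ {A B} (f : Hom A B) d → Dec (Renamed f d)
renamed? {A} f d = (d ∈ˢ? A) ×-dec Maybe.≡-dec Fin._≟_ (substPart f d) nothing

renamingPart-∈ : ∀ {A B} (f : Hom A B) {d} → Renamed f d → to (renamingPart f) d ∈ˢ B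
renamingPart-∈ {B = B} f {d} (p , e) with substPart-nothing f d p e
... | b , v≡b = subst (_∈ˢ B) (sym (renamingPart-value f d p b v≡b)) (proj₁ (value-inj₁ f d p b v≡b))

pulledBackSubst : ∀ {A B C} → Hom A B → Hom B C → ℕ → Maybe 𝟚
pulledBackSubst f g = restrictTo (renamed? f) (substPart g ∘ to (renamingPart f))

substPart-∘ : ∀ {A B C} (f : Hom A B) (g : Hom B C) d → d ∈ˢ A →
              (substPart f d <∣> pulledBackSubst f g d) ≡ substPart (g ∘𝒞 f) d
substPart-∘ f g d p with value f d p in eq
... | inj₂ i =
  begin
    substPart f d <∣> pulledBackSubst f g d
      ≡⟨ cong (_<∣> pulledBackSubst f g d) (trans (substPart-∈ f d p) (cong constant eq)) ⟩
    just i                ≡⟨ cong constant (value-∘-inj₂ f g d p i eq) ⟨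
    constant (value (g ∘𝒞 f) d p) ≡⟨ substPart-∈ (g ∘𝒞 f) d p ⟨
    substPart (g ∘𝒞 f) d  ∎
  where open ≡-Reasoning
... | inj₁ b with value-inj₁ f d p b eq
...   | q , _ =
  begin
    substPart f d <∣> pulledBackSubst f g d  ≡⟨ cong (_<∣> pulledBackSubst f g d) f-renames ⟩
    pulledBackSubst f g d                   ≡⟨ restrictTo-∈ (renamed? f) (substPart g ∘ to (renamingPart f)) (p , f-renames) ⟩
    substPart g (to (renamingPart f) d)   ≡⟨ cong (substPart g) (renamingPart-value f d p b eq) ⟩
    substPart g b                         ≡⟨ substPart-∈ g b q ⟩
    constant (value g b q)                ≡⟨ cong constant (value-∘-inj₁ f g d p b _ eq (λ q' → value-irr g b q' q)) ⟨
    constant (value (g ∘𝒞 f) d p)         ≡⟨ substPart-∈ (g ∘𝒞 f) d p ⟨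
    substPart (g ∘𝒞 f) d                  ∎
  where
  open ≡-Reasoning
  f-renames : substPart f d ≡ nothing
  f-renames = trans (substPart-∈ f d p) (cong constant eq)

renamingPart-∘ : ∀ {A B C} (f : Hom A B) (g : Hom B C) {d} → Renamed (g ∘𝒞 f) d →
                 to (renamingPart g ∘P renamingPart f) d ≡ to (renamingPart (g ∘𝒞 f)) d
renamingPart-∘ f g {d} (p , e) with substPart-nothing (g ∘𝒞 f) d p e
... | c , gf≡c with value f d p in eq
...   | inj₂ i with () ← trans (sym gf≡c) (value-∘-inj₂ f g d p i eq)
...   | inj₁ b with value-inj₁ f d p b eq
...     | q , _ =
  begin
    to (renamingPart g) (to (renamingPart f) d) ≡⟨ cong (to (renamingPart g)) (renamingPart-value f d p b eq) ⟩
    to (renamingPart g) b                       ≡⟨ renamingPart-value g b q c g≡c ⟩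
    c                                           ≡⟨ renamingPart-value (g ∘𝒞 f) d p c gf≡c ⟨
    to (renamingPart (g ∘𝒞 f)) d                ∎
  where
  open ≡-Reasoning
  g≡c : value g b q ≡ inj₁ c
  g≡c = trans (sym (value-∘-inj₁ f g d p b _ eq (λ q' → value-irr g b q' q))) gf≡c

-- The action of 𝒞 on a 01-substitution set

module HomAction (X : Raw01Sub) (S : Is01Sub X) where
  open Raw01Sub X
  open Is01Sub S
  open IsNominal isNominal
  open Substitution X S public

  -- Only meaningful on elements supported by A.
  homAct : ∀ {A B} → Hom A B → Carrier → Carrier
  homAct {A} f u = act (renamingPart f) (subAll u (elements A) (substPart f))

  homAct-cong : ∀ {A B} (f : Hom A B) {u v} → u ≈ v → homAct f u ≈ homAct f v
  homAct-cong {A} f e = act-cong (renamingPart f) (subAll-cong (elements A) (substPart f) e)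

  substituted-supportedBy : ∀ {A B} (f : Hom A B) {x} → Supports A x →
                            SupportedBy (Renamed f) (subAll x (elements A) (substPart f))
  substituted-supportedBy {A} f {x} s =
    supportedBy-mono (subAll-supportedBy (_∈ˢ A) A x (elements A) (substPart f) (λ d p → p) (_∈ˢ? A) s)
                     (λ { d (p , h) → p , h (∈-elements⁺ A p) })

  homAct-supports : ∀ {A B} (f : Hom A B) {x} → Supports A x → Supports B (homAct f x)
  homAct-supports f s = supportedBy-act (renamingPart f) (substituted-supportedBy f s) (λ d → renamingPart-∈ f)

  homAct-renaming : ∀ {A B} (f : Hom A B) (π : Perm) {x} → Supports A x →
                    (∀ a p → value f a p ≡ inj₁ (to π a)) → homAct f x ≈ act π x
  homAct-renaming {A} f π {x} s renames =
    ≈.reflexive (cong (act (renamingPart f)) (subAll-nothing x (elements A) (substPart f) nothing-substituted))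
    ⟨≈⟩ act-agree (renamingPart f) π s (λ d p → renamingPart-value f d p (to π d) (renames d p))
    where
    nothing-substituted : ∀ {a} → a ∈ elements A → substPart f a ≡ nothing
    nothing-substituted {a} m =
      trans (substPart-∈ f a (∈-elements⁻ A m)) (cong constant (renames a (∈-elements⁻ A m)))

  homAct-identity : ∀ {A B} (f : Hom A B) {x} → Supports A x → (∀ a p → value f a p ≡ inj₁ a) →
                    homAct f x ≈ x
  homAct-identity f s keeps = homAct-renaming f idP s keeps ⟨≈⟩ act-id _

  homAct-resp : ∀ {A B} (f g : Hom A B) → f ≈𝒞 g → ∀ {x} → Supports A x → homAct f x ≈ homAct g x
  homAct-resp {A} {B} f g f≈g {x} s =
    ≈.reflexive (cong (act (renamingPart f))
                      (subAll-ext x (elements A) (substPart f) (substPart g) (λ {a} _ → substPart-resp f g f≈g a)))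
    ⟨≈⟩ act-agree (renamingPart f) (renamingPart g) (substituted-supportedBy g s) agree
    where
    agree : ∀ d → Renamed g d → to (renamingPart f) d ≡ to (renamingPart g) d
    agree d (p , e) with substPart-nothing g d p e
    ... | b , v≡b = trans (renamingPart-value f d p b (trans (value-resp f g f≈g d p) v≡b))
                          (sym (renamingPart-value g d p b v≡b))

  homAct-fsub : ∀ A a i {x} → Supports A x → homAct (fsub A a i) x ≈ sub x a i
  homAct-fsub A a i {x} s with a ∈ˢ? A
  ... | no a∉A =
    homAct-identity (fsub A a i) s (λ d p → value-fsub-≢ A a i d p (λ { refl → a∉A p }))
    ⟨≈⟩ ≈.sym (sub-trivial (_∈ˢ A) A a i (λ d p → p) s a∉A)
  ... | yes a∈A = act-cong π (pulled ⟨≈⟩ rest-trivial) ⟨≈⟩ supported π fixes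
    where
    f = fsub A a i
    π = renamingPart f
    σ = substPart f
    σa : σ a ≡ just i
    σa = trans (substPart-∈ f a a∈A) (cong constant (value-fsub-≡ A a i a a∈A refl))
    pulled : subAll x (elements A) σ ≈ subAll (sub? x a (σ a)) (elements A) (unset σ a)
    pulled = subAll-pull x (elements A) σ (∈-elements⁺ A a∈A) (elements-unique A)
    rest-trivial : subAll (sub? x a (σ a)) (elements A) (unset σ a) ≈ sub x a i
    rest-trivial rewrite σa = ≈.reflexive (subAll-nothing (sub x a i) (elements A) (unset σ a) unset-nothing)
      where
      unset-nothing : ∀ {d} → d ∈ elements A → unset σ a d ≡ nothing
      unset-nothing {d} m with d ≟ a
      ... | yes _  = refl
      ... | no d≢a = trans (substPart-∈ f d (∈-elements⁻ A m))
                           (cong constant (value-fsub-≢ A a i d (∈-elements⁻ A m) d≢a))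
    supported : SupportedBy (λ d → d ∈ˢ A × d ≢ a) (sub x a i)
    supported = supportedBy-fresh A (_∈ˢ A) a (λ d p → p)
                  (sub-supportedBy (_∈ˢ A) A a i (λ d p → p) s (yes a∈A)) (sub-fresh x a i)
    fixes : ∀ d → d ∈ˢ A × d ≢ a → to π d ≡ d
    fixes d (p , d≢a) = renamingPart-value f d p d (value-fsub-≢ A a i d p d≢a)

  homAct-∘ : ∀ {A B C} (f : Hom A B) (g : Hom B C) {x} → Supports A x → homAct (g ∘𝒞 f) x ≈ homAct g (homAct f x)
  homAct-∘ {A} {B} f g {x} s = ≈.sym (
        act-cong πg (subAll-act πf z (elements B) (substPart g))
    ⟨≈⟩ ≈.sym (act-comp πg πf _)
    ⟨≈⟩ act-cong (πg ∘P πf) substitutions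
    ⟨≈⟩ act-agree (πg ∘P πf) (renamingPart (g ∘𝒞 f)) (substituted-supportedBy (g ∘𝒞 f) s) (λ d → renamingPart-∘ f g))
    where
    πf = renamingPart f
    πg = renamingPart g
    z = subAll x (elements A) (substPart f)
    M = lmap (from πf) (elements B)
    τ = pulledBackSubst f g
    M-unique : Unique M
    M-unique = Unique.map⁺ (to-injective (invP πf)) (elements-unique B)
    τ⊆A : Within τ (elements A)
    τ⊆A defined = ∈-elements⁺ A (proj₁ (restrictTo-defined (renamed? f) _ defined))
    τ⊆M : Within τ M
    τ⊆M {d} defined = subst (_∈ M) (from-to πf d) (∈-map⁺ (from πf) (∈-elements⁺ B (renamingPart-∈ f r)))
      where
      r = restrictTo-defined (renamed? f) _ defined
    disjoint : ∀ d → substPart f d ≡ nothing ⊎ τ d ≡ nothing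
    disjoint d with renamed? f d
    ... | yes (_ , e) = inj₁ e
    ... | no _        = inj₂ refl
    substitutions : subAll z M (substPart g ∘ to πf) ≈ subAll x (elements A) (substPart (g ∘𝒞 f))
    substitutions =
          subAll-restrict (Renamed f) A z M _ (renamed? f) (λ d → proj₁) (substituted-supportedBy f s)
      ⟨≈⟩ ≈.sym (subAll-reorder z (elements A) M τ (elements-unique A) M-unique τ⊆A τ⊆M)
      ⟨≈⟩ subAll-merge x (elements A) (substPart f) τ (elements-unique A) disjoint
      ⟨≈⟩ ≈.reflexive (subAll-ext x (elements A) _ (substPart (g ∘𝒞 f))
                                   (λ m → substPart-∘ f g _ (∈-elements⁻ A m)))

module _ {X Y : Raw01Sub} (SX : Is01Sub X) (SY : Is01Sub Y) {g : Raw01Sub.Carrier X → Raw01Sub.Carrier Y}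
         (g-hom : IsHom X Y g) where
  private
    module X = HomAction X SX
    module Y = HomAction Y SY
  open IsHom g-hom
  open Raw01Sub Y using (_≈_)

  hom-subAll : ∀ u N σ → g (X.subAll u N σ) ≈ Y.subAll (g u) N σ
  hom-subAll u []      σ = Y.≈.refl
  hom-subAll u (a ∷ N) σ = hom-subAll _ N σ Y.⟨≈⟩ Y.subAll-cong N σ (hom-sub? (σ a))
    where
    hom-sub? : ∀ m → g (X.sub? u a m) ≈ Y.sub? (g u) a m
    hom-sub? nothing  = Y.≈.refl
    hom-sub? (just i) = hom-sub u a i

  hom-homAct : ∀ {A B} (f : Hom A B) u → g (X.homAct f u) ≈ Y.homAct f (g u)
  hom-homAct {A} f u =
    hom-equiv (renamingPart f) _ Y.⟨≈⟩ IsNominal.act-cong (Is01Sub.isNominal SY) (renamingPart f) (hom-subAll u (elements A) (substPart f))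

retractFun : ∀ A b → Dec (b ∈ˢ A) → El A ⊎ 𝟚
retractFun A b (yes p) = inj₁ (b , p)
retractFun A b (no _)  = inj₂ fz

retractFun-inj₁ : ∀ A b b∈? (e : El A) → retractFun A b b∈? ≡ inj₁ e → b ≡ proj₁ e
retractFun-inj₁ A b (yes p) _ refl = refl

-- The names outside A are sent to the arbitrary constant 0.
retract : ∀ B A → Hom B A
retract B A = record
  { fun = λ b _ → retractFun A b (b ∈ˢ? A)
  ; inj = λ b p b' p' e h h' → trans (retractFun-inj₁ A b _ e h) (sym (retractFun-inj₁ A b' _ e h')) }

value-retract-∈ : ∀ B A b q → b ∈ˢ A → value (retract B A) b q ≡ inj₁ b
value-retract-∈ B A b q p with b ∈ˢ? A
... | yes _  = refl
... | no b∉A = ⊥-elim (b∉A p)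

value-retract-inj₁ : ∀ B A b q c → value (retract B A) b q ≡ inj₁ c → c ≡ b
value-retract-inj₁ B A b q c e with b ∈ˢ? A
value-retract-inj₁ B A b q c refl | yes _ = refl

module I*HomAction (F : Presheaf) where
  open Presheaf F
  open I*Structure F public
  open HomAction (I* F) is01Sub public hiding (_⟨≈⟩_)
  open Raw01Sub (I* F)

  subAll-stage : ∀ A x N σ → (∀ {a} → a ∈ˢ A → σ a ≢ nothing → a ∈ N) →
                 Σ FinSub λ A' → Σ (Hom A A') λ h →
                   subAll (A , x) N σ ≈ (A' , map h x) × (∀ a p → value h a p ≡ maybe′ inj₂ (inj₁ a) (σ a))
  subAll-stage A x [] σ σ⊆N = A , id𝒞 , ≈-map-id x , kept
    where
    kept : ∀ a p → value (id𝒞 {A}) a p ≡ maybe′ inj₂ (inj₁ a) (σ a)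
    kept a p with σ a in e
    ... | nothing = refl
    ... | just i with () ← σ⊆N p (λ e' → just≢nothing (trans (sym e) e'))
  subAll-stage A x (b ∷ N) σ σ⊆N with σ b in eb
  ... | nothing = subAll-stage A x N σ σ⊆N'
    where
    σ⊆N' : ∀ {a} → a ∈ˢ A → σ a ≢ nothing → a ∈ N
    σ⊆N' p defined with σ⊆N p defined
    ... | here refl = ⊥-elim (defined eb)
    ... | there m   = m
  ... | just i with subAll-stage (remove b A) (map (fsub A b i) x) N σ σ⊆N'
    where
    σ⊆N' : ∀ {a} → a ∈ˢ remove b A → σ a ≢ nothing → a ∈ N
    σ⊆N' p defined with ∈-remove⁻ _ _ A p
    ... | p' , a≢b with σ⊆N p' defined
    ...   | here a≡b = ⊥-elim (a≢b a≡b)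
    ...   | there m  = m
  ... | A' , h , e , values = A' , h ∘𝒞 fsub A b i , e ⟨~⟩ ≈-at (FB.sym A' (map-∘ (fsub A b i) h x)) , values'
    where
    values' : ∀ a p → value (h ∘𝒞 fsub A b i) a p ≡ maybe′ inj₂ (inj₁ a) (σ a)
    values' a p = by-cases (a ≟ b)
      where
      by-cases : Dec (a ≡ b) → value (h ∘𝒞 fsub A b i) a p ≡ maybe′ inj₂ (inj₁ a) (σ a)
      by-cases (yes refl) = trans (value-∘-fsub-≡ a i h a p refl) (cong (maybe′ inj₂ (inj₁ a)) (sym eb))
      by-cases (no a≢b)   = trans (value-∘-fsub-≢ b i h a p q a≢b) (values a q)
        where q = rem-mem b a A p a≢b

  map-homAct : ∀ {A B} (f : Hom A B) x → (B , map f x) ≈ homAct f (A , x)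
  map-homAct {A} {B} f x with subAll-stage A x (elements A) (substPart f) (λ p _ → ∈-elements⁺ A p)
  ... | A' , h , e , values =
    ≐∘⇒≈ f h (restrict (renamingPart f) A') x factor ⟨~⟩ ≈-sym (IsNominal.act-cong isNominal (renamingPart f) e)
    where
    factor : f ≐ restrict (renamingPart f) A' ∘𝒞 h
    factor a p with value f a p in eq
    ... | inj₁ b = sym (value-∘-inj₁ h (restrict (renamingPart f) A') a p a (inj₁ b) h-keeps
                         (λ q → cong inj₁ (renamingPart-value f a p b eq)))
      where
      h-keeps : value h a p ≡ inj₁ a
      h-keeps = trans (values a p) (cong (maybe′ inj₂ (inj₁ a)) (trans (substPart-∈ f a p) (cong constant eq)))
    ... | inj₂ i = sym (value-∘-inj₂ h (restrict (renamingPart f) A') a p i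
                         (trans (values a p) (cong (maybe′ inj₂ (inj₁ a)) (trans (substPart-∈ f a p) (cong constant eq)))))

  ≈-stage-injective : ∀ {A x y} → (A , x) ≈ (A , y) → x ≈[ A ] y
  ≈-stage-injective {A} {x} {y} (B , s , s' , e) =
    begin
      x                                   ≈⟨ map-id x ⟨
      map id𝒞 x                                  ≈⟨ map-≐ (incl s) (retract B A) x (retract-incl s) ⟩
      map (retract B A) (map (incl {A} {B} s) x)  ≈⟨ map-cong (retract B A) e ⟩
      map (retract B A) (map (incl {A} {B} s') y) ≈⟨ map-≐ (incl s') (retract B A) y (retract-incl s') ⟨
      map id𝒞 y                                  ≈⟨ map-id y ⟩
      y                                   ∎
    where
    open SetoidReasoning (obj A)
    retract-incl : (t : A ⊆ˢ B) → id𝒞 ≐ retract B A ∘𝒞 incl {A} {B} t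
    retract-incl t a p = sym (value-retract-∈ B A a (t a p) p)

  restage : ∀ {A B y} → Supports A (B , y) → (A , map (retract B A) y) ≈ (B , y)
  restage {A} {B} {y} s =
    map-homAct (retract B A) y
    ⟨~⟩ IsNominal.act-cong isNominal π substitutions-trivial
    ⟨~⟩ IsNominal.act-ext isNominal π idP (renamingPart-id (retract B A) (value-retract-inj₁ B A)) (B , y)
    ⟨~⟩ IsNominal.act-id isNominal (B , y)
    where
    π = renamingPart (retract B A)
    outside-A : ∀ {a} → a ∈ elements B → substPart (retract B A) a ≢ nothing → ¬ (a ∈ˢ A)
    outside-A {a} m defined p =
      defined (trans (substPart-∈ (retract B A) a q) (cong constant (value-retract-∈ B A a q p)))
      where q = ∈-elements⁻ B m
    substitutions-trivial : subAll (B , y) (elements B) (substPart (retract B A)) ≈ (B , y)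
    substitutions-trivial = subAll-trivial (_∈ˢ A) A (B , y) (elements B) _ (λ d p → p) s outside-A

I*₁-hom : ∀ F G (φ : NatTrans F G) → IsHom (I* F) (I* G) (I*₁ φ)
I*₁-hom F G φ = record
  { hom-cong  = λ { {A , x} {A' , x'} (B , s , s' , e) →
      B , s , s' , G.trans B (G.sym B (natural φ (incl s) x)) (G.trans B (η-cong φ B e) (natural φ (incl s') x')) }
  ; hom-equiv = λ { π (A , x) → I*Structure.≈-at G (natural φ (restrict π A) x) }
  ; hom-sub   = λ { (A , x) a i → I*Structure.≈-at G (natural φ (fsub A a i) x) }
  }
  where
  module G (B : FinSub) = Setoid (Presheaf.obj G B)

I*₁-resp : ∀ F G (φ ψ : NatTrans F G) → φ ≈N ψ → ∀ u → Raw01Sub._≈_ (I* G) (I*₁ φ u) (I*₁ ψ u)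
I*₁-resp F G φ ψ φ≈ψ (A , x) = I*Structure.≈-at G (φ≈ψ A x)

I*-functor : I*-IsFunctor
I*-functor = I*Structure.is01Sub , I*₁-hom , I*₁-resp ,
             (λ F u → I*Structure.≈-refl F) , (λ F G H φ ψ u → I*Structure.≈-refl H)

I*-faithful : I*-Faithful
I*-faithful F G φ ψ same A x = I*HomAction.≈-stage-injective G (same (A , x))

module Fullness (F G : Presheaf) (g : Raw01Sub.Carrier (I* F) → Raw01Sub.Carrier (I* G))
                (g-hom : IsHom (I* F) (I* G) g) where
  private
    module IF = I*HomAction F
    module IG = I*HomAction G
    module F = Presheaf F
    module G = Presheaf G
  open IsHom g-hom
  open IG using (_⟨~⟩_; ≈-sym)

  -- g (A , x) is supported by A, so it is represented at stage A.
  component : ∀ A → F.∣ A ∣ → G.∣ A ∣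
  component A x = G.map (retract (proj₁ (g (A , x))) A) (proj₂ (g (A , x)))

  represents : ∀ A x → Raw01Sub._≈_ (I* G) (A , component A x) (g (A , x))
  represents A x = IG.restage (λ π fix → ≈-sym (hom-equiv π (A , x)) ⟨~⟩ hom-cong (IF.supports-stage A x π fix))

  induced : NatTrans F G
  induced = record
    { η       = component
    ; η-cong  = λ A {x} {x'} e → IG.≈-stage-injective (represents A x ⟨~⟩ hom-cong (IF.≈-at e) ⟨~⟩ ≈-sym (represents A x'))
    ; natural = λ {A} {B} f x → IG.≈-stage-injective (
          represents B (F.map f x)
          ⟨~⟩ hom-cong (IF.map-homAct f x)
          ⟨~⟩ hom-homAct IF.is01Sub IG.is01Sub g-hom f (A , x)
          ⟨~⟩ IG.homAct-cong f (≈-sym (represents A x))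
          ⟨~⟩ ≈-sym (IG.map-homAct f (component A x)))
    }

I*-full : I*-Full
I*-full F G g g-hom = Fullness.induced F G g g-hom , λ { (A , x) → Fullness.represents F G g g-hom A x }

module CubicalSetOf (X : Raw01Sub) (S : Is01Sub X) where
  open Raw01Sub X
  open Is01Sub S
  open IsNominal isNominal
  open HomAction X S

  stage : FinSub → Setoid 0ℓ 0ℓ
  stage A = record
    { Carrier       = Σ Carrier (Supports A)
    ; _≈_           = λ u v → proj₁ u ≈ proj₁ v
    ; isEquivalence = record { refl = ≈.refl ; sym = ≈.sym ; trans = ≈.trans }
    }

  cubicalSet : Presheaf
  cubicalSet = record
    { obj      = stage
    ; map      = λ f u → homAct f (proj₁ u) , homAct-supports f (proj₂ u)
    ; map-cong = λ f e → homAct-cong f e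
    ; map-resp = λ {_} {_} {f} {g} f≈g u → homAct-resp f g f≈g (proj₂ u)
    ; map-id   = λ {A} u → homAct-identity (id𝒞 {A}) (proj₂ u) (λ a p → refl)
    ; map-∘    = λ f g u → homAct-∘ f g (proj₂ u)
    }

  private
    module I = Raw01Sub (I* cubicalSet)

  forget : I.Carrier → Carrier
  forget (A , (x , _)) = x

  support : Carrier → FinSub
  support x = proj₁ (finsupp x)

  supported : ∀ x → Supports (support x) x
  supported x = proj₂ (finsupp x)

  represent : Carrier → I.Carrier
  represent x = support x , (x , supported x)

  ≈-classes : ∀ A A' {x x'} (s : Supports A x) (s' : Supports A' x') → x ≈ x' → (A , (x , s)) I.≈ (A' , (x' , s'))
  ≈-classes A A' s s' e =
    A ∪ˢ A' , ⊆-∪ˡ A A' , ⊆-∪ʳ A A' ,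
    (homAct-identity (incl {A} {A ∪ˢ A'} (⊆-∪ˡ A A')) s (λ a p → refl) ⟨≈⟩ e
     ⟨≈⟩ ≈.sym (homAct-identity (incl {A'} {A ∪ˢ A'} (⊆-∪ʳ A A')) s' (λ a p → refl)))

  represent-forget : ∀ u → represent (forget u) I.≈ u
  represent-forget (A , (x , s)) = ≈-classes (support x) A (supported x) s ≈.refl

  forget-hom : IsHom (I* cubicalSet) X forget
  forget-hom = record
    { hom-cong  = λ { {A , (x , s)} {A' , (x' , s')} (B , t , t' , e) →
        ≈.sym (homAct-identity (incl {A} {B} t) s (λ a p → refl)) ⟨≈⟩ e
        ⟨≈⟩ homAct-identity (incl {A'} {B} t') s' (λ a p → refl) }
    ; hom-equiv = λ { π (A , (x , s)) → homAct-renaming (restrict π A) π s (λ a p → refl) }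
    ; hom-sub   = λ { (A , (x , s)) a i → homAct-fsub A a i s }
    }

  represent-hom : IsHom X (I* cubicalSet) represent
  represent-hom = record
    { hom-cong  = λ {x} {y} e → ≈-classes (support x) (support y) (supported x) (supported y) e
    ; hom-equiv = λ π x →
        ≈-classes (support (act π x)) (image (to π) (support x)) (supported (act π x))
                  (homAct-supports (restrict π (support x)) (supported x))
                  (≈.sym (homAct-renaming (restrict π (support x)) π (supported x) (λ a p → refl)))
    ; hom-sub   = λ x a i →
        ≈-classes (support (sub x a i)) (remove a (support x)) (supported (sub x a i))
                  (homAct-supports (fsub (support x) a i) (supported x))
                  (≈.sym (homAct-fsub (support x) a i (supported x)))
    }

I*-essSurj : I*-EssSurj
I*-essSurj X S =
  cubicalSet , forget , represent , forget-hom , represent-hom , (λ x → ≈.refl) , represent-forget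
  where
  open CubicalSetOf X S
  open Nominal X (Is01Sub.isNominal S) using (module ≈)

theorem1 : I*-IsFunctor × I*-Faithful × I*-Full × I*-EssSurj
theorem1 = I*-functor , I*-faithful , I*-full , I*-essSurj
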